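{- Let $\pi=\pi_1\cdots\pi_n\in S_n$ and let $d$ be a tail-bound descent of $\pi$. Then \[|\mathrm{VHC}(\pi)|=\sum_{H\in\mathrm{SW}_d(\pi)}|\mathrm{VHC}(\pi_U^H)|\cdot|\mathrm{VHC}(\pi_S^H)|.\]
   Context: A permutation is a finite sequence of distinct positive integers written as a word; $S_n$ is the set of permutations of $[n]$. The plot of $\pi=\pi_1\cdots\pi_n$ is $\{(i,\pi_i)\}$. A descent is $i\in[n-1]$ with $\pi_i>\pi_{i+1}$; $(i,\pi_i)$ is then a descent top. A hook of $\pi$ is determined by $i<j$ with $\pi_i<\pi_j$: the vertical segment from $(i,\pi_i)$ up to $(i,\pi_j)$ followed by the horizontal segment to $(j,\pi_j)$; $(i,\pi_i)$ is its southwest endpoint and $(j,\pi_j)$ its northeast endpoint. If $\pi$ has descents $d_1<\cdots<d_k$, a valid hook configuration of $\pi$ is a tuple $(H_1,\dots,H_k)$ of hooks such that (1) $H_i$ has southwest endpoint $(d_i,\pi_{d_i})$; (2) no point of the plot lies directly above a hook; (3) hooks do not intersect or overlap except that the northeast endpoint of one may be the southwest endpoint of another. $\mathrm{VHC}(\pi)$ is the set of these; an increasing permutation (including the empty one) has exactly one valid hook configuration (with no hooks). The tail length $\mathrm{tl}(\pi)$ of $\pi\in S_n$ is the smallest nonnegative $\ell$ with $\pi_{n-\ell}\ne n-\ell$ (with $\mathrm{tl}(12\cdots n)=n$); if $\mathrm{tl}(\pi)=\ell$, the tail of $\pi$ is the list of points $(n-\ell+1,n-\ell+1),\dots,(n,n)$.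 $\mathrm{SW}_d(\pi)$ is the set of hooks of $\pi$ with southwest endpoint $(d,\pi_d)$. A descent $d$ of $\pi$ is tail-bound if every hook in $\mathrm{SW}_d(\pi)$ has its northeast endpoint in the tail of $\pi$. For a hook $H$ with southwest endpoint $(i,\pi_i)$ and northeast endpoint $(j,\pi_j)$, the $H$-unsheltered subpermutation is $\pi_U^H=\pi_1\cdots\pi_i\pi_{j+1}\cdots\pi_n$ and the $H$-sheltered subpermutation is $\pi_S^H=\pi_{i+1}\cdots\pi_{j-1}$ (valid hook configurations of these non-normalized permutations are defined in the same way). -}

module Defs where

open import Data.Nat using (ℕ; zero; suc; _+_; _∸_; _<_; _≤_; _≟_; _<?_; _≤?_)
open import Data.Product using (_×_; _,_; proj₁; proj₂)
open import Data.Product.Properties using () renaming (≡-dec to ×-≡-dec)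
open import Data.Sum using (_⊎_)
open import Data.List using (List; []; _∷_; map; filter; length; upTo; _++_; concatMap; reverse; takeWhile; take; drop)
open import Data.List.Properties using () renaming (≡-dec to List-≡-dec)
open import Data.List.Relation.Unary.All using (All; all?)
open import Data.List.Relation.Unary.AllPairs using (AllPairs; allPairs?)
open import Relation.Nullary using (Dec; ¬_; ¬?)
open import Relation.Nullary.Decidable using (_×-dec_; _⊎-dec_; _→-dec_)
open import Relation.Binary.PropositionalEquality using (_≡_)

-- Words (permutations, possibly non-normalized) are lists of naturals.
-- Positions are 1-indexed.

range : ℕ → ℕ → List ℕ
range a b = map (a +_) (upTo (suc b ∸ a))

-- at π k = π_k  (1-indexed; 0 outside 1..length π, never used there)
at : List ℕ → ℕ → ℕ
at []       _             = 0
at (x ∷ xs) zero          = 0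
at (x ∷ xs) (suc zero)    = x
at (x ∷ xs) (suc (suc k)) = at xs (suc k)

positions : List ℕ → List ℕ
positions π = range 1 (length π)

IsDescent : List ℕ → ℕ → Set
IsDescent π i = 1 ≤ i × i < length π × at π (suc i) < at π i

isDescent? : (π : List ℕ) (i : ℕ) → Dec (IsDescent π i)
isDescent? π i = (1 ≤? i) ×-dec (i <? length π) ×-dec (at π (suc i) <? at π i)

descents : List ℕ → List ℕ
descents π = filter (isDescent? π) (positions π)

-- Hooks.  A hook is given by the pair (i , j) of positions of its
-- southwest endpoint (i , π_i) and northeast endpoint (j , π_j).

Point : Set
Point = ℕ × ℕ

Hook : Set
Hook = ℕ × ℕ

IsHook : List ℕ → Hook → Set
IsHook π (i , j) = 1 ≤ i × i < j × j ≤ length π × at π i < at π j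

isHook? : (π : List ℕ) (h : Hook) → Dec (IsHook π h)
isHook? π (i , j) = (1 ≤? i) ×-dec (i <? j) ×-dec (j ≤? length π) ×-dec (at π i <? at π j)

swPt : List ℕ → Hook → Point
swPt π (i , j) = (i , at π i)

nePt : List ℕ → Hook → Point
nePt π (i , j) = (j , at π j)

hookPoints : List ℕ → Hook → List Point
hookPoints π (i , j) =
  map (λ y → (i , y)) (range (at π i) (at π j)) ++ map (λ x → (x , at π j)) (range i j)

_∈P_ : Point → List Point → Set
p ∈P [] = Data.Empty.⊥ where import Data.Empty
p ∈P (q ∷ qs) = (p ≡ q) ⊎ (p ∈P qs)

_∈P?_ : (p : Point) (ps : List Point) → Dec (p ∈P ps)
p ∈P? [] = Relation.Nullary.no (λ ()) where import Relation.Nullary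
p ∈P? (q ∷ qs) = ×-≡-dec _≟_ _≟_ p q ⊎-dec (p ∈P? qs)

-- (2) no point (k , π_k) of the plot lies directly above a point of the hook
NothingAbove : List ℕ → Hook → Set
NothingAbove π h =
  All (λ k → All (λ p → ¬ (proj₁ p ≡ k × proj₂ p < at π k)) (hookPoints π h)) (positions π)

nothingAbove? : (π : List ℕ) (h : Hook) → Dec (NothingAbove π h)
nothingAbove? π h =
  all? (λ k → all? (λ p → ¬? ((proj₁ p ≟ k) ×-dec (proj₂ p <? at π k))) (hookPoints π h)) (positions π)

-- (3) two hooks meet only in a point that is the northeast endpoint of
-- one of them and the southwest endpoint of the other
Compatible : List ℕ → Hook → Hook → Set
Compatible π h h' =
  All (λ p → p ∈P hookPoints π h' →
               ((p ≡ nePt π h × p ≡ swPt π h') ⊎ (p ≡ nePt π h' × p ≡ swPt π h)))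
      (hookPoints π h)

compatible? : (π : List ℕ) (h h' : Hook) → Dec (Compatible π h h')
compatible? π h h' =
  all? (λ p → (p ∈P? hookPoints π h') →-dec
              ((×-≡-dec _≟_ _≟_ p (nePt π h) ×-dec ×-≡-dec _≟_ _≟_ p (swPt π h'))
               ⊎-dec (×-≡-dec _≟_ _≟_ p (nePt π h') ×-dec ×-≡-dec _≟_ _≟_ p (swPt π h))))
       (hookPoints π h)

IsVHC : List ℕ → List Hook → Set
IsVHC π c =
  map proj₁ c ≡ descents π
  × All (IsHook π) c
  × All (NothingAbove π) c
  × AllPairs (Compatible π) c

isVHC? : (π : List ℕ) (c : List Hook) → Dec (IsVHC π c)
isVHC? π c =
  List-≡-dec _≟_ (map proj₁ c) (descents π)
  ×-dec all? (isHook? π) c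
  ×-dec all? (nothingAbove? π) c
  ×-dec allPairs? (compatible? π) c

choices : {A : Set} → List (List A) → List (List A)
choices []         = [] ∷ []
choices (xs ∷ xss) = concatMap (λ x → map (x ∷_) (choices xss)) xs

-- every tuple of pairs (d_i , j_i) with d_i < j_i ≤ n; each VHC occurs
-- exactly once in this list
candidates : List ℕ → List (List Hook)
candidates π = choices (map (λ d → map (d ,_) (range (suc d) (length π))) (descents π))

numVHC : List ℕ → ℕ
numVHC π = length (filter (isVHC? π) (candidates π))

-- tl(π): smallest ℓ with π_{n-ℓ} ≠ n-ℓ (= n if no such ℓ < n)
tl : List ℕ → ℕ
tl π = length (takeWhile (λ k → at π k ≟ k) (reverse (positions π)))

InTail : List ℕ → ℕ → Set
InTail π j = length π ∸ tl π < j × j ≤ length π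

SW : List ℕ → ℕ → List Hook
SW π d = filter (isHook? π) (map (d ,_) (range (suc d) (length π)))

TailBound : List ℕ → ℕ → Set
TailBound π d = IsDescent π d × All (λ h → InTail π (proj₂ h)) (SW π d)

unsheltered : List ℕ → Hook → List ℕ
unsheltered π (i , j) = take i π ++ drop j π

sheltered : List ℕ → Hook → List ℕ
sheltered π (i , j) = take (j ∸ suc i) (drop i π)

-- Sort the valid hook configurations of π by their hook H = (d , j) at the descent d.
-- Since d is tail-bound, j lies in the tail: π_j = j, every point strictly between
-- columns d and j lies below height π_j, and every point after j lies above it.
-- Consequently a hook starting left of d is compatible with H exactly when it ends at
-- or before d or after j, a hook starting under H is compatible with H exactly when it
-- ends before j, and hooks of these two kinds never interfere. After relabelling
-- positions, the first kind of hooks are the valid hook configurations of π_U^H (whose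
-- descents are those of π before d) and the second those of π_S^H (whose descents are
-- those of π between d and j), so the configurations through H number
-- |VHC(π_U^H)| · |VHC(π_S^H)|.

module Submission where

open import Defs
open import Data.Nat using (ℕ; zero; suc; _+_; _*_; _∸_; _<_; _≤_; _≟_; _<?_; _≤?_; z≤n; s≤s; z<s)
open import Data.Nat.Properties
open import Algebra.Properties.CommutativeSemigroup +-commutativeSemigroup using () renaming (interchange to +-interchange)
open import Data.Nat.ListAction using (sum)
open import Data.Nat.ListAction.Properties using (sum-++)
open import Data.Product as Product using (_×_; _,_; proj₁; proj₂; Σ-syntax)
open import Data.Product.Properties using (×-≡,≡←≡)
open import Data.Sum as Sum using (_⊎_; inj₁; inj₂)
open import Data.Empty using (⊥; ⊥-elim)
open import Data.List using (List; []; _∷_; map; filter; length; applyUpTo; _++_; concatMap; reverse; takeWhile; take; drop)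
open import Data.List.Properties using (map-++; map-∘; map-cong-local; map-id-local; map-upTo; filter-++; filter-none; filter-accept; filter-reject; filter-all; length-++; length-map; length-take; length-drop; reverse-++; ++-identityʳ)
open import Data.List.Relation.Unary.All as All using (All; []; _∷_; all?)
open import Data.List.Relation.Unary.All.Properties as All using ()
open import Data.List.Relation.Unary.AllPairs as AllPairs using (AllPairs; []; _∷_)
open import Data.List.Relation.Unary.AllPairs.Properties as AllPairs using ()
open import Data.List.Membership.Propositional using (_∈_; find)
open import Data.List.Membership.Propositional.Properties using (∈-map⁻; ∈-map⁺; ∈-concatMap⁻; ∈-filter⁻; ∈-filter⁺; ∈-++⁻; ∈-++⁺ˡ; ∈-++⁺ʳ)
open import Data.List.Relation.Unary.Any using (here; there)
open import Function using (_∘_; _⇔_; mk⇔; Equivalence)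
open import Relation.Nullary using (Dec; yes; no; ¬_)
open import Relation.Nullary.Decidable using (_×-dec_; _⊎-dec_)
open import Level using (0ℓ)
open import Relation.Unary using (Pred; Decidable)
open import Relation.Binary using (Rel)
open import Relation.Binary.PropositionalEquality
open import Data.List.Relation.Binary.Permutation.Propositional using (_↭_)

open Equivalence using (to; from)

consecutive : ℕ → ℕ → List ℕ
consecutive a zero    = []
consecutive a (suc l) = a ∷ consecutive (suc a) l

applyUpTo-cong : ∀ {f g : ℕ → ℕ} → (∀ i → f i ≡ g i) → ∀ l → applyUpTo f l ≡ applyUpTo g l
applyUpTo-cong f≗g zero    = refl
applyUpTo-cong f≗g (suc l) = cong₂ _∷_ (f≗g 0) (applyUpTo-cong (f≗g ∘ suc) l)

applyUpTo-+≡consecutive : ∀ a l → applyUpTo (a +_) l ≡ consecutive a l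
applyUpTo-+≡consecutive a zero    = refl
applyUpTo-+≡consecutive a (suc l) = cong₂ _∷_ (+-identityʳ a)
  (trans (applyUpTo-cong (+-suc a) l) (applyUpTo-+≡consecutive (suc a) l))

range≡consecutive : ∀ a b → range a b ≡ consecutive a (suc b ∸ a)
range≡consecutive a b = trans (map-upTo (a +_) (suc b ∸ a)) (applyUpTo-+≡consecutive a _)

positions≡consecutive : ∀ π → positions π ≡ consecutive 1 (length π)
positions≡consecutive π = range≡consecutive 1 (length π)

∈-consecutive⁻ : ∀ {a l x} → x ∈ consecutive a l → a ≤ x × x < a + l
∈-consecutive⁻ {a} {suc l} (here refl) = ≤-refl , m<m+n a z<s
∈-consecutive⁻ {a} {suc l} {x} (there x∈) with ∈-consecutive⁻ {suc a} {l} x∈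
... | a<x , x<a+1+l = <⇒≤ a<x , subst (x <_) (sym (+-suc a l)) x<a+1+l

∈-consecutive⁺ : ∀ {a l x} → a ≤ x → x < a + l → x ∈ consecutive a l
∈-consecutive⁺ {a} {zero}  a≤x x<a+0 = ⊥-elim (<⇒≱ (subst (_ <_) (+-identityʳ a) x<a+0) a≤x)
∈-consecutive⁺ {a} {suc l} {x} a≤x x<a+l with a ≟ x
... | yes refl = here refl
... | no a≢x   = there (∈-consecutive⁺ (≤∧≢⇒< a≤x a≢x) (subst (x <_) (+-suc a l) x<a+l))

∈-range⁻ : ∀ {a b x} → x ∈ range a b → a ≤ x × x ≤ b
∈-range⁻ {a} {b} {x} x∈ with ∈-consecutive⁻ (subst (x ∈_) (range≡consecutive a b) x∈)
... | a≤x , x<a+[1+b∸a] = a≤x , ≤-pred (≤-trans x<a+[1+b∸a] (≤-reflexive a+[1+b∸a]≡1+b))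
  where
  a+[1+b∸a]≡1+b : a + (suc b ∸ a) ≡ suc b
  a+[1+b∸a]≡1+b with a ≤? suc b
  ... | yes a≤1+b = m+[n∸m]≡n a≤1+b
  ... | no a≰1+b  = ⊥-elim (<⇒≱ (≤-trans x<a+[1+b∸a] (≤-reflexive (trans
          (cong (a +_) (m≤n⇒m∸n≡0 (<⇒≤ (≰⇒> a≰1+b)))) (+-identityʳ a)))) a≤x)

∈-range⁺ : ∀ {a b x} → a ≤ x → x ≤ b → x ∈ range a b
∈-range⁺ {a} {b} {x} a≤x x≤b = subst (x ∈_) (sym (range≡consecutive a b))
  (∈-consecutive⁺ a≤x (subst (x <_) (sym (m+[n∸m]≡n (≤-trans a≤x (m≤n⇒m≤1+n x≤b)))) (s≤s x≤b)))

consecutive-++ : ∀ a l₁ l₂ → consecutive a (l₁ + l₂) ≡ consecutive a l₁ ++ consecutive (a + l₁) l₂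
consecutive-++ a zero     l₂ = cong (λ b → consecutive b l₂) (sym (+-identityʳ a))
consecutive-++ a (suc l₁) l₂ = cong (a ∷_) (trans (consecutive-++ (suc a) l₁ l₂)
  (cong (λ b → consecutive (suc a) l₁ ++ consecutive b l₂) (sym (+-suc a l₁))))

consecutive-split : ∀ {a b c} → a ≤ b → b ≤ c → consecutive a (c ∸ a) ≡ consecutive a (b ∸ a) ++ consecutive b (c ∸ b)
consecutive-split {a} {b} {c} a≤b b≤c = begin
  consecutive a (c ∸ a)                               ≡⟨ cong (consecutive a) c∸a≡[b∸a]+[c∸b] ⟩
  consecutive a ((b ∸ a) + (c ∸ b))                   ≡⟨ consecutive-++ a (b ∸ a) (c ∸ b) ⟩
  consecutive a (b ∸ a) ++ consecutive (a + (b ∸ a)) (c ∸ b) ≡⟨ cong (λ x → consecutive a (b ∸ a) ++ consecutive x (c ∸ b)) (m+[n∸m]≡n a≤b) ⟩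
  consecutive a (b ∸ a) ++ consecutive b (c ∸ b)      ∎
  where
  open ≡-Reasoning
  a+[[b∸a]+[c∸b]]≡c : a + ((b ∸ a) + (c ∸ b)) ≡ c
  a+[[b∸a]+[c∸b]]≡c = trans (sym (+-assoc a _ _)) (trans (cong (_+ (c ∸ b)) (m+[n∸m]≡n a≤b)) (m+[n∸m]≡n b≤c))
  c∸a≡[b∸a]+[c∸b] : c ∸ a ≡ (b ∸ a) + (c ∸ b)
  c∸a≡[b∸a]+[c∸b] = trans (cong (_∸ a) (sym a+[[b∸a]+[c∸b]]≡c)) (m+n∸m≡n a _)

∈-consecutive-∸⁻ : ∀ {a b x} → a ≤ b → x ∈ consecutive a (b ∸ a) → a ≤ x × x < b
∈-consecutive-∸⁻ {a} {b} {x} a≤b x∈ with ∈-consecutive⁻ x∈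
... | a≤x , x<a+[b∸a] = a≤x , subst (x <_) (m+[n∸m]≡n a≤b) x<a+[b∸a]

map-+-consecutive : ∀ c a l → map (c +_) (consecutive a l) ≡ consecutive (c + a) l
map-+-consecutive c a zero    = refl
map-+-consecutive c a (suc l) = cong (c + a ∷_)
  (trans (map-+-consecutive c (suc a) l) (cong (λ b → consecutive b l) (+-suc c a)))

map-∸-consecutive : ∀ c a l → map (_∸ c) (consecutive (c + a) l) ≡ consecutive a l
map-∸-consecutive c a l = begin
  map (_∸ c) (consecutive (c + a) l)          ≡⟨ cong (map (_∸ c)) (map-+-consecutive c a l) ⟨
  map (_∸ c) (map (c +_) (consecutive a l))   ≡⟨ map-∘ (consecutive a l) ⟨
  map (λ x → c + x ∸ c) (consecutive a l)     ≡⟨ map-id-local (All.tabulate (λ _ → m+n∸m≡n c _)) ⟩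
  consecutive a l                             ∎
  where open ≡-Reasoning

reverse-consecutive-suc : ∀ n → reverse (consecutive 1 (suc n)) ≡ suc n ∷ reverse (consecutive 1 n)
reverse-consecutive-suc n = begin
  reverse (consecutive 1 (suc n))                    ≡⟨ cong (reverse ∘ consecutive 1) (+-comm 1 n) ⟩
  reverse (consecutive 1 (n + 1))                    ≡⟨ cong reverse (consecutive-++ 1 n 1) ⟩
  reverse (consecutive 1 n ++ consecutive (suc n) 1) ≡⟨ reverse-++ (consecutive 1 n) _ ⟩
  suc n ∷ reverse (consecutive 1 n)                  ∎
  where open ≡-Reasoning

takeWhile-reverse-consecutive : {P : Pred ℕ 0ℓ} (P? : Decidable P) → ∀ n k →
  n ∸ length (takeWhile P? (reverse (consecutive 1 n))) < k → k ≤ n → P k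
takeWhile-reverse-consecutive P? zero    k n<k k≤n = ⊥-elim (<⇒≱ n<k k≤n)
takeWhile-reverse-consecutive P? (suc n) k lt  k≤n rewrite reverse-consecutive-suc n with P? (suc n)
... | no _  = ⊥-elim (<⇒≱ lt k≤n)
... | yes p with k ≟ suc n
...   | yes refl = p
...   | no k≢1+n = takeWhile-reverse-consecutive P? n k lt (≤-pred (≤∧≢⇒< k≤n k≢1+n))

InTail⇒fixed : ∀ π {k} → InTail π k → at π k ≡ k
InTail⇒fixed π {k} (n∸tl<k , k≤n) = takeWhile-reverse-consecutive (λ i → at π i ≟ i) (length π) k
  (subst (λ ps → length π ∸ length (takeWhile (λ i → at π i ≟ i) (reverse ps)) < k)
         (positions≡consecutive π) n∸tl<k) k≤n

at-0 : ∀ π → at π 0 ≡ 0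
at-0 []      = refl
at-0 (_ ∷ _) = refl

at-∷ : ∀ x π {k} → 1 ≤ k → at (x ∷ π) (suc k) ≡ at π k
at-∷ x π {suc k} _ = refl

at-++ˡ : ∀ π ρ {k} → k ≤ length π → at (π ++ ρ) k ≡ at π k
at-++ˡ []      ρ {zero}        _         = at-0 ρ
at-++ˡ (x ∷ π) ρ {zero}        _         = refl
at-++ˡ (x ∷ π) ρ {suc zero}    _         = refl
at-++ˡ (x ∷ π) ρ {suc (suc k)} (s≤s k<) = at-++ˡ π ρ k<

at-++ʳ : ∀ π ρ {k} → 1 ≤ k → at (π ++ ρ) (length π + k) ≡ at ρ k
at-++ʳ []      ρ     _   = refl
at-++ʳ (x ∷ π) ρ {k} 1≤k = trans (at-∷ x (π ++ ρ) (≤-trans 1≤k (m≤n+m k _))) (at-++ʳ π ρ 1≤k)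

at-take : ∀ π t {k} → k ≤ t → at (take t π) k ≡ at π k
at-take π       t       {zero}        _        = trans (at-0 (take t π)) (sym (at-0 π))
at-take []      zero    {suc k}       ()
at-take []      (suc t) {suc k}       _        = refl
at-take (x ∷ π) (suc t) {suc zero}    _        = refl
at-take (x ∷ π) (suc t) {suc (suc k)} (s≤s k<) = at-take π t k<

at-drop : ∀ π t {k} → 1 ≤ k → at (drop t π) k ≡ at π (t + k)
at-drop π       zero    _   = refl
at-drop []      (suc t) {suc k} _ = refl
at-drop (x ∷ π) (suc t) {k} 1≤k = trans (at-drop π t 1≤k) (sym (at-∷ x π (≤-trans 1≤k (m≤n+m k t))))

-- Counting over lists of choices

indicator : {Q : Set} → Dec Q → ℕ
indicator (yes _) = 1
indicator (no _)  = 0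

module _ {A B : Set} where

  sum-map-map : (f : B → ℕ) (g : A → B) (xs : List A) → sum (map f (map g xs)) ≡ sum (map (f ∘ g) xs)
  sum-map-map f g xs = cong sum (sym (map-∘ xs))

  sum-map-concatMap : (f : B → ℕ) (g : A → List B) (xs : List A) →
    sum (map f (concatMap g xs)) ≡ sum (map (λ x → sum (map f (g x))) xs)
  sum-map-concatMap f g []       = refl
  sum-map-concatMap f g (x ∷ xs) = begin
    sum (map f (g x ++ concatMap g xs))              ≡⟨ cong sum (map-++ f (g x) _) ⟩
    sum (map f (g x) ++ map f (concatMap g xs))      ≡⟨ sum-++ (map f (g x)) _ ⟩
    sum (map f (g x)) + sum (map f (concatMap g xs)) ≡⟨ cong (_ +_) (sum-map-concatMap f g xs) ⟩
    sum (map (λ x → sum (map f (g x))) (x ∷ xs))    ∎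
    where open ≡-Reasoning

module _ {A : Set} where

  sum-map-cong-∈ : {f g : A → ℕ} (xs : List A) → (∀ {x} → x ∈ xs → f x ≡ g x) →
    sum (map f xs) ≡ sum (map g xs)
  sum-map-cong-∈ xs f≡g = cong sum (map-cong-local (All.tabulate f≡g))

  sum-map-const-0 : (xs : List A) → sum (map (λ _ → 0) xs) ≡ 0
  sum-map-const-0 []       = refl
  sum-map-const-0 (_ ∷ xs) = sum-map-const-0 xs

  sum-map-+ : (f g : A → ℕ) (xs : List A) → sum (map (λ x → f x + g x) xs) ≡ sum (map f xs) + sum (map g xs)
  sum-map-+ f g []       = refl
  sum-map-+ f g (x ∷ xs) = trans (cong (f x + g x +_) (sum-map-+ f g xs)) (+-interchange (f x) (g x) _ _)

  sum-map-*ʳ : (c : ℕ) (f : A → ℕ) (xs : List A) → sum (map (λ x → f x * c) xs) ≡ sum (map f xs) * c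
  sum-map-*ʳ c f []       = refl
  sum-map-*ʳ c f (x ∷ xs) = trans (cong (f x * c +_) (sum-map-*ʳ c f xs)) (sym (*-distribʳ-+ c (f x) _))

sum-map-comm : {A B : Set} (f : A → B → ℕ) (xs : List A) (ys : List B) →
  sum (map (λ x → sum (map (f x) ys)) xs) ≡ sum (map (λ y → sum (map (λ x → f x y) xs)) ys)
sum-map-comm f []       ys = sym (sum-map-const-0 ys)
sum-map-comm f (x ∷ xs) ys = trans (cong (sum (map (f x) ys) +_) (sum-map-comm f xs ys))
  (sym (sum-map-+ (f x) (λ y → sum (map (λ x → f x y) xs)) ys))

module _ {A : Set} where

  count : {P : Pred A 0ℓ} → Decidable P → List A → ℕ
  count P? xs = length (filter P? xs)

  filter-cong-∈ : {P Q : Pred A 0ℓ} (P? : Decidable P) (Q? : Decidable Q) (xs : List A) →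
    (∀ {x} → x ∈ xs → P x ⇔ Q x) → filter P? xs ≡ filter Q? xs
  filter-cong-∈ P? Q? []       _   = refl
  filter-cong-∈ P? Q? (x ∷ xs) P⇔Q with P? x | Q? x
  ... | yes _ | yes _ = cong (x ∷_) (filter-cong-∈ P? Q? xs (P⇔Q ∘ there))
  ... | yes p | no ¬q = ⊥-elim (¬q (to (P⇔Q (here refl)) p))
  ... | no ¬p | yes q = ⊥-elim (¬p (from (P⇔Q (here refl)) q))
  ... | no _  | no _  = filter-cong-∈ P? Q? xs (P⇔Q ∘ there)

  count-cong-∈ : {P Q : Pred A 0ℓ} (P? : Decidable P) (Q? : Decidable Q) (xs : List A) →
    (∀ {x} → x ∈ xs → P x ⇔ Q x) → count P? xs ≡ count Q? xs
  count-cong-∈ P? Q? xs P⇔Q = cong length (filter-cong-∈ P? Q? xs P⇔Q)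

  count-++ : {P : Pred A 0ℓ} (P? : Decidable P) (xs ys : List A) → count P? (xs ++ ys) ≡ count P? xs + count P? ys
  count-++ P? xs ys = trans (cong length (filter-++ P? xs ys)) (length-++ (filter P? xs))

  count-none : {P : Pred A 0ℓ} (P? : Decidable P) (xs : List A) → (∀ {x} → x ∈ xs → ¬ P x) → count P? xs ≡ 0
  count-none P? xs ¬P = cong length (filter-none P? (All.tabulate ¬P))

  count≡sum-indicator : {P : Pred A 0ℓ} (P? : Decidable P) (xs : List A) → count P? xs ≡ sum (map (indicator ∘ P?) xs)
  count≡sum-indicator P? []       = refl
  count≡sum-indicator P? (x ∷ xs) with P? x
  ... | yes _ = cong suc (count≡sum-indicator P? xs)
  ... | no _  = count≡sum-indicator P? xs

  count-const-× : {P R : Pred A 0ℓ} {Q : Set} (P? : Decidable P) (Q? : Dec Q) (R? : Decidable R) (xs : List A) →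
    (∀ {x} → x ∈ xs → P x ⇔ (Q × R x)) → count P? xs ≡ indicator Q? * count R? xs
  count-const-× P? (yes q) R? xs P⇔Q×R = trans (count-cong-∈ P? R? xs
    (λ x∈ → mk⇔ (proj₂ ∘ to (P⇔Q×R x∈)) (λ r → from (P⇔Q×R x∈) (q , r)))) (sym (+-identityʳ _))
  count-const-× P? (no ¬q) R? xs P⇔Q×R = count-none P? xs (λ x∈ → ¬q ∘ proj₁ ∘ to (P⇔Q×R x∈))

  sum-map-filter : {K : Pred A 0ℓ} (K? : Decidable K) (f : A → ℕ) (xs : List A) →
    sum (map f (filter K? xs)) ≡ sum (map (λ x → indicator (K? x) * f x) xs)
  sum-map-filter K? f []       = refl
  sum-map-filter K? f (x ∷ xs) with K? x
  ... | yes _ = cong₂ _+_ (sym (+-identityʳ (f x))) (sum-map-filter K? f xs)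
  ... | no _  = sum-map-filter K? f xs

module _ {A B : Set} where

  filter-map : {P : Pred B 0ℓ} (P? : Decidable P) (f : A → B) (xs : List A) →
    filter P? (map f xs) ≡ map f (filter (P? ∘ f) xs)
  filter-map P? f []       = refl
  filter-map P? f (x ∷ xs) with P? (f x)
  ... | yes _ = cong (f x ∷_) (filter-map P? f xs)
  ... | no _  = filter-map P? f xs

  count-map : {P : Pred B 0ℓ} (P? : Decidable P) (f : A → B) (xs : List A) → count P? (map f xs) ≡ count (P? ∘ f) xs
  count-map P? f xs = trans (cong length (filter-map P? f xs)) (length-map f (filter (P? ∘ f) xs))

  count-concatMap : {P : Pred B 0ℓ} (P? : Decidable P) (f : A → List B) (xs : List A) →
    count P? (concatMap f xs) ≡ sum (map (count P? ∘ f) xs)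
  count-concatMap P? f []       = refl
  count-concatMap P? f (x ∷ xs) = trans (count-++ P? (f x) (concatMap f xs)) (cong (count P? (f x) +_) (count-concatMap P? f xs))

module _ {A : Set} where

  count-choices-∷ : {P : Pred (List A) 0ℓ} (P? : Decidable P) (xs : List A) (xss : List (List A)) →
    count P? (choices (xs ∷ xss)) ≡ sum (map (λ x → count (P? ∘ (x ∷_)) (choices xss)) xs)
  count-choices-∷ P? xs xss = trans (count-concatMap P? (λ x → map (x ∷_) (choices xss)) xs)
    (sum-map-cong-∈ xs (λ {x} _ → count-map P? (x ∷_) (choices xss)))

module _ {A : Set} where

  count-choices-++ : {P : Pred (List A) 0ℓ} (P? : Decidable P) (xss yss : List (List A)) →
    count P? (choices (xss ++ yss)) ≡ sum (map (λ a → count (P? ∘ (a ++_)) (choices yss)) (choices xss))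
  count-choices-++ P? []         yss = sym (+-identityʳ _)
  count-choices-++ P? (xs ∷ xss) yss = begin
    count P? (choices (xs ∷ xss ++ yss))
      ≡⟨ count-choices-∷ P? xs (xss ++ yss) ⟩
    sum (map (λ x → count (P? ∘ (x ∷_)) (choices (xss ++ yss))) xs)
      ≡⟨ sum-map-cong-∈ xs (λ {x} _ → count-choices-++ (P? ∘ (x ∷_)) xss yss) ⟩
    sum (map (λ x → sum (map (λ a → count (λ b → P? (x ∷ a ++ b)) (choices yss)) (choices xss))) xs)
      ≡⟨ sum-map-cong-∈ xs (λ {x} _ → sum-map-map _ (x ∷_) (choices xss)) ⟨
    sum (map (λ x → sum (map (λ a → count (P? ∘ (a ++_)) (choices yss)) (map (x ∷_) (choices xss)))) xs)
      ≡⟨ sum-map-concatMap _ (λ x → map (x ∷_) (choices xss)) xs ⟨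
    sum (map (λ a → count (P? ∘ (a ++_)) (choices yss)) (choices (xs ∷ xss)))
      ∎
    where open ≡-Reasoning

  count-choices-map : {B : Set} {P : Pred (List B) 0ℓ} (P? : Decidable P) (g : A → B) (xss : List (List A)) →
    count P? (choices (map (map g) xss)) ≡ count (P? ∘ map g) (choices xss)
  count-choices-map P? g [] with P? []
  ... | yes _ = refl
  ... | no _  = refl
  count-choices-map P? g (xs ∷ xss) = begin
    count P? (choices (map g xs ∷ map (map g) xss))
      ≡⟨ count-choices-∷ P? (map g xs) (map (map g) xss) ⟩
    sum (map (λ y → count (P? ∘ (y ∷_)) (choices (map (map g) xss))) (map g xs))
      ≡⟨ sum-map-map _ g xs ⟩
    sum (map (λ x → count (P? ∘ (g x ∷_)) (choices (map (map g) xss))) xs)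
      ≡⟨ sum-map-cong-∈ xs (λ {x} _ → count-choices-map (P? ∘ (g x ∷_)) g xss) ⟩
    sum (map (λ x → count (P? ∘ map g ∘ (x ∷_)) (choices xss)) xs)
      ≡⟨ count-choices-∷ (P? ∘ map g) xs xss ⟨
    count (P? ∘ map g) (choices (xs ∷ xss))
      ∎
    where open ≡-Reasoning

  count-choices-filter : {K : Pred A 0ℓ} (K? : Decidable K) {P : Pred (List A) 0ℓ} (P? : Decidable P)
    (xss : List (List A)) →
    count P? (choices (map (filter K?) xss)) ≡ count (λ a → all? K? a ×-dec P? a) (choices xss)
  count-choices-filter K? P? [] = count-cong-∈ P? (λ a → all? K? a ×-dec P? a) ([] ∷ [])
    (λ { (here refl) → mk⇔ ([] ,_) proj₂ })
  count-choices-filter K? P? (xs ∷ xss) = begin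
    count P? (choices (filter K? xs ∷ map (filter K?) xss))
      ≡⟨ count-choices-∷ P? (filter K? xs) (map (filter K?) xss) ⟩
    sum (map (λ y → count (P? ∘ (y ∷_)) (choices (map (filter K?) xss))) (filter K? xs))
      ≡⟨ sum-map-filter K? _ xs ⟩
    sum (map (λ x → indicator (K? x) * count (P? ∘ (x ∷_)) (choices (map (filter K?) xss))) xs)
      ≡⟨ sum-map-cong-∈ xs (λ {x} _ → cong (indicator (K? x) *_) (count-choices-filter K? (P? ∘ (x ∷_)) xss)) ⟩
    sum (map (λ x → indicator (K? x) * count (λ a → all? K? a ×-dec P? (x ∷ a)) (choices xss)) xs)
      ≡⟨ sum-map-cong-∈ xs (λ {x} _ → sym (count-const-× _ (K? x) _ (choices xss)
           (λ _ → mk⇔ (λ { (kx ∷ ka , p) → kx , ka , p }) (λ { (kx , ka , p) → kx ∷ ka , p })))) ⟩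
    sum (map (λ x → count (λ a → all? K? (x ∷ a) ×-dec P? (x ∷ a)) (choices xss)) xs)
      ≡⟨ count-choices-∷ (λ a → all? K? a ×-dec P? a) xs xss ⟨
    count (λ a → all? K? a ×-dec P? a) (choices (xs ∷ xss))
      ∎
    where open ≡-Reasoning

  ∈-choices⇒heads : {B : Set} (f : A → List B) (ds : List A) {c : List (A × B)} →
    c ∈ choices (map (λ e → map (e ,_) (f e)) ds) → map proj₁ c ≡ ds
  ∈-choices⇒heads f []       (here refl) = refl
  ∈-choices⇒heads f (e ∷ ds) c∈ with find (∈-concatMap⁻ (λ x → map (x ∷_) _) {xs = map (e ,_) (f e)} c∈)
  ... | x , x∈ , c∈x with ∈-map⁻ (x ∷_) c∈x | ∈-map⁻ (e ,_) x∈
  ... | c′ , c′∈ , refl | _ , _ , refl = cong (e ∷_) (∈-choices⇒heads f ds c′∈)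

module _ {A : Set} {Q : Pred A 0ℓ} {R S : Rel A 0ℓ} where

  AllPairs-map-local : ∀ {xs} → All Q xs → (∀ {x y} → Q x → Q y → R x y → S x y) → AllPairs R xs → AllPairs S xs
  AllPairs-map-local []         _ []         = []
  AllPairs-map-local (qx ∷ qxs) f (rx ∷ rxs) =
    All.zipWith (λ (qy , r) → f qx qy r) (qxs , rx) ∷ AllPairs-map-local qxs f rxs

module _ {A : Set} {R : Rel A 0ℓ} where

  AllPairs-++-∷⁻ : ∀ xs {y ys} → AllPairs R (xs ++ y ∷ ys) →
    AllPairs R xs × All (λ x → R x y) xs × All (λ x → All (R x) ys) xs × All (R y) ys × AllPairs R ys
  AllPairs-++-∷⁻ []       (ry ∷ rys) = [] , [] , [] , ry , rys
  AllPairs-++-∷⁻ (x ∷ xs) (rx ∷ rxs) with AllPairs-++-∷⁻ xs rxs | All.++⁻ xs rx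
  ... | rxs′ , rxs-y , rxs-ys , ry , rys | rx-xs , rxy ∷ rx-ys =
    (rx-xs ∷ rxs′) , (rxy ∷ rxs-y) , (rx-ys ∷ rxs-ys) , ry , rys

  AllPairs-++-∷⁺ : ∀ {xs y ys} → AllPairs R xs → All (λ x → R x y) xs → All (λ x → All (R x) ys) xs →
    All (R y) ys → AllPairs R ys → AllPairs R (xs ++ y ∷ ys)
  AllPairs-++-∷⁺ rxs rxs-y rxs-ys ry rys =
    AllPairs.++⁺ rxs (ry ∷ rys) (All.zipWith (λ (rxy , rx-ys) → rxy ∷ rx-ys) (rxs-y , rxs-ys))

OnHook : List ℕ → Hook → Point → Set
OnHook π (i , k) (x , y) = (x ≡ i × at π i ≤ y × y ≤ at π k) ⊎ (i ≤ x × x ≤ k × y ≡ at π k)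

∈-hookPoints⁻ : ∀ π h {p} → p ∈ hookPoints π h → OnHook π h p
∈-hookPoints⁻ π (i , k) p∈ with ∈-++⁻ (map (i ,_) (range (at π i) (at π k))) p∈
... | inj₁ p∈ver with ∈-map⁻ (i ,_) p∈ver
...   | _ , y∈ , refl = inj₁ (refl , ∈-range⁻ y∈)
∈-hookPoints⁻ π (i , k) p∈ | inj₂ p∈hor with ∈-map⁻ (_, at π k) p∈hor
...   | _ , x∈ , refl = inj₂ (proj₁ (∈-range⁻ x∈) , proj₂ (∈-range⁻ x∈) , refl)

∈-hookPoints⁺ : ∀ π h {p} → OnHook π h p → p ∈ hookPoints π h
∈-hookPoints⁺ π (i , k) (inj₁ (refl , πi≤y , y≤πk)) = ∈-++⁺ˡ (∈-map⁺ (i ,_) (∈-range⁺ πi≤y y≤πk))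
∈-hookPoints⁺ π (i , k) (inj₂ (i≤x , x≤k , refl)) =
  ∈-++⁺ʳ (map (i ,_) (range (at π i) (at π k))) (∈-map⁺ (_, at π k) (∈-range⁺ i≤x x≤k))

∈P⇒∈ : ∀ {p} ps → p ∈P ps → p ∈ ps
∈P⇒∈ (q ∷ ps) (inj₁ p≡q) = here p≡q
∈P⇒∈ (q ∷ ps) (inj₂ p∈) = there (∈P⇒∈ ps p∈)

∈⇒∈P : ∀ {p} ps → p ∈ ps → p ∈P ps
∈⇒∈P (q ∷ ps) (here p≡q) = inj₁ p≡q
∈⇒∈P (q ∷ ps) (there p∈) = inj₂ (∈⇒∈P ps p∈)

onHook-col≥ : ∀ π {i k x y} → OnHook π (i , k) (x , y) → i ≤ x
onHook-col≥ π (inj₁ (refl , _)) = ≤-refl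
onHook-col≥ π (inj₂ (i≤x , _))  = i≤x

onHook-row≤ : ∀ π {i k x y} → OnHook π (i , k) (x , y) → y ≤ at π k
onHook-row≤ π (inj₁ (_ , _ , y≤πk)) = y≤πk
onHook-row≤ π (inj₂ (_ , _ , refl)) = ≤-refl

NothingAbove′ : List ℕ → Hook → Set
NothingAbove′ π (i , k) = ∀ x → i ≤ x → x ≤ k → at π x ≤ at π k

NothingAbove⇒′ : ∀ π h → IsHook π h → NothingAbove π h → NothingAbove′ π h
NothingAbove⇒′ π h@(i , k) (1≤i , _ , k≤n , _) noneAbove x i≤x x≤k = ≮⇒≥ λ πk<πx →
  All.lookup (All.lookup noneAbove (∈-range⁺ (≤-trans 1≤i i≤x) (≤-trans x≤k k≤n)))
    (∈-hookPoints⁺ π h (inj₂ (i≤x , x≤k , refl))) (refl , πk<πx)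

NothingAbove′⇒ : ∀ π h → NothingAbove′ π h → NothingAbove π h
NothingAbove′⇒ π h noneAbove′ =
  All.tabulate λ {x} _ → All.tabulate λ p∈ → notBelow (∈-hookPoints⁻ π h p∈)
  where
  notBelow : ∀ {x p} → OnHook π h p → ¬ (proj₁ p ≡ x × proj₂ p < at π x)
  notBelow (inj₁ (refl , πi≤y , _))  (refl , y<πi) = <⇒≱ y<πi πi≤y
  notBelow (inj₂ (i≤x , x≤k , refl)) (refl , πk<πx) = <⇒≱ πk<πx (noneAbove′ _ i≤x x≤k)

Joint : List ℕ → Hook → Hook → Point → Set
Joint π h h′ p = (p ≡ nePt π h × p ≡ swPt π h′) ⊎ (p ≡ nePt π h′ × p ≡ swPt π h)

Compatible′ : List ℕ → Hook → Hook → Set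
Compatible′ π h h′ = ∀ p → OnHook π h p → OnHook π h′ p → Joint π h h′ p

Compatible⇒′ : ∀ π h h′ → Compatible π h h′ → Compatible′ π h h′
Compatible⇒′ π h h′ compat p p∈h p∈h′ =
  All.lookup compat (∈-hookPoints⁺ π h p∈h) (∈⇒∈P _ (∈-hookPoints⁺ π h′ p∈h′))

Compatible′⇒ : ∀ π h h′ → Compatible′ π h h′ → Compatible π h h′
Compatible′⇒ π h h′ compat′ = All.tabulate λ p∈h p∈h′ →
  compat′ _ (∈-hookPoints⁻ π h p∈h) (∈-hookPoints⁻ π h′ (∈P⇒∈ _ p∈h′))

-- Relabelling positions

WithinBounds : List ℕ → Hook → Set
WithinBounds W (i , k) = 1 ≤ i × k ≤ length W

IsHook⇒WithinBounds : ∀ W h → IsHook W h → WithinBounds W h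
IsHook⇒WithinBounds W h (1≤i , _ , k≤n , _) = 1≤i , k≤n

-- W is the subword of π at the positions σ 1 < σ 2 < ⋯ < σ (length W).
module Relabelling (W π : List ℕ) (σ : ℕ → ℕ)
  (σ-mono   : ∀ {x y} → x ≤ y → σ x ≤ σ y)
  (σ-cancel : ∀ {x y} → σ x ≤ σ y → x ≤ y)
  (σ-pos    : ∀ {x} → 1 ≤ x → 1 ≤ σ x)
  (σ-bound  : ∀ {x} → x ≤ length W → σ x ≤ length π)
  (at-σ     : ∀ {x} → 1 ≤ x → x ≤ length W → at W x ≡ at π (σ x)) where

  relabel : Hook → Hook
  relabel (i , k) = σ i , σ k

  σ-injective : ∀ {x y} → σ x ≡ σ y → x ≡ y
  σ-injective σx≡σy = ≤-antisym (σ-cancel (≤-reflexive σx≡σy)) (σ-cancel (≤-reflexive (sym σx≡σy)))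

  σ-mono-< : ∀ {x y} → x < y → σ x < σ y
  σ-mono-< x<y = ≤∧≢⇒< (σ-mono (<⇒≤ x<y)) (λ σx≡σy → <-irrefl (σ-injective σx≡σy) x<y)

  σ-cancel-< : ∀ {x y} → σ x < σ y → x < y
  σ-cancel-< σx<σy = ≰⇒> (λ y≤x → <⇒≱ σx<σy (σ-mono y≤x))

  module _ {i k : ℕ} (bounds : WithinBounds W (i , k)) (i≤k : i ≤ k) where

    at-σ-sw : at W i ≡ at π (σ i)
    at-σ-sw = at-σ (proj₁ bounds) (≤-trans i≤k (proj₂ bounds))

    at-σ-ne : at W k ≡ at π (σ k)
    at-σ-ne = at-σ (≤-trans (proj₁ bounds) i≤k) (proj₂ bounds)

    at-σ-between : ∀ {x} → i ≤ x → x ≤ k → at W x ≡ at π (σ x)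
    at-σ-between i≤x x≤k = at-σ (≤-trans (proj₁ bounds) i≤x) (≤-trans x≤k (proj₂ bounds))

  isHook⁺ : ∀ h → IsHook W h → IsHook π (relabel h)
  isHook⁺ h hk@(1≤i , i<k , k≤n , πi<πk) =
    σ-pos 1≤i , σ-mono-< i<k , σ-bound k≤n ,
    subst₂ _<_ (at-σ-sw bounds (<⇒≤ i<k)) (at-σ-ne bounds (<⇒≤ i<k)) πi<πk
    where bounds = IsHook⇒WithinBounds W h hk

  isHook⁻ : ∀ h → WithinBounds W h → IsHook π (relabel h) → IsHook W h
  isHook⁻ h bounds@(1≤i , k≤n) (_ , σi<σk , _ , πσi<πσk) =
    1≤i , i<k , k≤n ,
    subst₂ _<_ (sym (at-σ-sw bounds (<⇒≤ i<k))) (sym (at-σ-ne bounds (<⇒≤ i<k))) πσi<πσk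
    where i<k = σ-cancel-< σi<σk

  nothingAbove⁻ : ∀ h → WithinBounds W h → NothingAbove′ π (relabel h) → NothingAbove′ W h
  nothingAbove⁻ h bounds noneAbove x i≤x x≤k =
    subst₂ _≤_ (sym (at-σ-between bounds (≤-trans i≤x x≤k) i≤x x≤k)) (sym (at-σ-ne bounds (≤-trans i≤x x≤k)))
      (noneAbove (σ x) (σ-mono i≤x) (σ-mono x≤k))

  -- Columns of π skipped by σ must be checked separately: that is the role of the last hypothesis.
  nothingAbove⁺ : ∀ h → IsHook W h → NothingAbove′ W h →
    (∀ x′ → σ (proj₁ h) ≤ x′ → x′ ≤ σ (proj₂ h) →
      (Σ[ x ∈ ℕ ] x′ ≡ σ x) ⊎ at π x′ ≤ at π (σ (proj₂ h))) →
    NothingAbove′ π (relabel h)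
  nothingAbove⁺ h hk noneAbove skipped x′ σi≤x′ x′≤σk with skipped x′ σi≤x′ x′≤σk
  ... | inj₂ below = below
  ... | inj₁ (x , refl) =
    subst₂ _≤_ (at-σ-between bounds i≤k i≤x x≤k) (at-σ-ne bounds i≤k) (noneAbove x i≤x x≤k)
    where
    bounds = IsHook⇒WithinBounds W h hk
    i≤x = σ-cancel σi≤x′
    x≤k = σ-cancel x′≤σk
    i≤k = ≤-trans i≤x x≤k

  onHook⁺ : ∀ h → IsHook W h → ∀ {x y} → OnHook W h (x , y) → OnHook π (relabel h) (σ x , y)
  onHook⁺ h hk (inj₁ (refl , πi≤y , y≤πk)) =
    inj₁ (refl , subst (_≤ _) (at-σ-sw bounds i≤k) πi≤y , subst (_ ≤_) (at-σ-ne bounds i≤k) y≤πk)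
    where
    bounds = IsHook⇒WithinBounds W h hk
    i≤k = <⇒≤ (proj₁ (proj₂ hk))
  onHook⁺ h hk (inj₂ (i≤x , x≤k , refl)) =
    inj₂ (σ-mono i≤x , σ-mono x≤k , at-σ-ne (IsHook⇒WithinBounds W h hk) (<⇒≤ (proj₁ (proj₂ hk))))

  onHook⁻ : ∀ h → IsHook W h → ∀ {x y} → OnHook π (relabel h) (σ x , y) → OnHook W h (x , y)
  onHook⁻ h hk (inj₁ (σx≡σi , πi≤y , y≤πk)) with σ-injective σx≡σi
  ... | refl = inj₁ (refl , subst (_≤ _) (sym (at-σ-sw bounds i≤k)) πi≤y , subst (_ ≤_) (sym (at-σ-ne bounds i≤k)) y≤πk)
    where
    bounds = IsHook⇒WithinBounds W h hk
    i≤k = <⇒≤ (proj₁ (proj₂ hk))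
  onHook⁻ h hk (inj₂ (σi≤σx , σx≤σk , refl)) =
    inj₂ (σ-cancel σi≤σx , σ-cancel σx≤σk , sym (at-σ-ne (IsHook⇒WithinBounds W h hk) (<⇒≤ (proj₁ (proj₂ hk)))))

  private
    point⁻ : ∀ {x y k} → 1 ≤ k → k ≤ length W → (σ x , y) ≡ (σ k , at π (σ k)) → (x , y) ≡ (k , at W k)
    point⁻ 1≤k k≤n eq with ×-≡,≡←≡ eq
    ... | σx≡σk , y≡πσk with σ-injective σx≡σk
    ...   | refl = cong (_ ,_) (trans y≡πσk (sym (at-σ 1≤k k≤n)))

    point⁺ : ∀ {x y k} → 1 ≤ k → k ≤ length W → (x , y) ≡ (k , at W k) → (σ x , y) ≡ (σ k , at π (σ k))
    point⁺ 1≤k k≤n refl = cong (_ ,_) (at-σ 1≤k k≤n)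

    ne⁻ : ∀ h → IsHook W h → ∀ {x y} → (σ x , y) ≡ nePt π (relabel h) → (x , y) ≡ nePt W h
    ne⁻ h (1≤i , i<k , k≤n , _) = point⁻ (≤-trans 1≤i (<⇒≤ i<k)) k≤n

    sw⁻ : ∀ h → IsHook W h → ∀ {x y} → (σ x , y) ≡ swPt π (relabel h) → (x , y) ≡ swPt W h
    sw⁻ h (1≤i , i<k , k≤n , _) = point⁻ 1≤i (≤-trans (<⇒≤ i<k) k≤n)

    ne⁺ : ∀ h → IsHook W h → ∀ {x y} → (x , y) ≡ nePt W h → (σ x , y) ≡ nePt π (relabel h)
    ne⁺ h (1≤i , i<k , k≤n , _) = point⁺ (≤-trans 1≤i (<⇒≤ i<k)) k≤n

    sw⁺ : ∀ h → IsHook W h → ∀ {x y} → (x , y) ≡ swPt W h → (σ x , y) ≡ swPt π (relabel h)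
    sw⁺ h (1≤i , i<k , k≤n , _) = point⁺ 1≤i (≤-trans (<⇒≤ i<k) k≤n)

  joint⁻ : ∀ h h′ → IsHook W h → IsHook W h′ → ∀ {x y} →
    Joint π (relabel h) (relabel h′) (σ x , y) → Joint W h h′ (x , y)
  joint⁻ h h′ hk hk′ = Sum.map (Product.map (ne⁻ h hk) (sw⁻ h′ hk′)) (Product.map (ne⁻ h′ hk′) (sw⁻ h hk))

  joint⁺ : ∀ h h′ → IsHook W h → IsHook W h′ → ∀ {x y} →
    Joint W h h′ (x , y) → Joint π (relabel h) (relabel h′) (σ x , y)
  joint⁺ h h′ hk hk′ = Sum.map (Product.map (ne⁺ h hk) (sw⁺ h′ hk′)) (Product.map (ne⁺ h′ hk′) (sw⁺ h hk))

  compatible⁻ : ∀ h h′ → IsHook W h → IsHook W h′ →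
    Compatible′ π (relabel h) (relabel h′) → Compatible′ W h h′
  compatible⁻ h h′ hk hk′ compat (x , y) on-h on-h′ =
    joint⁻ h h′ hk hk′ (compat (σ x , y) (onHook⁺ h hk on-h) (onHook⁺ h′ hk′ on-h′))

  compatible⁺ : ∀ h h′ → IsHook W h → IsHook W h′ → Compatible′ W h h′ →
    (∀ p → OnHook π (relabel h) p → OnHook π (relabel h′) p → Σ[ x ∈ ℕ ] proj₁ p ≡ σ x) →
    Compatible′ π (relabel h) (relabel h′)
  compatible⁺ h h′ hk hk′ compat meetsInImage p on-h on-h′ with meetsInImage p on-h on-h′
  ... | x , refl = joint⁺ h h′ hk hk′ (compat (x , _) (onHook⁻ h hk on-h) (onHook⁻ h′ hk′ on-h′))

-- Sorting configurations by their hook at a descent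

hooksFrom : List ℕ → ℕ → List Hook
hooksFrom π e = map (e ,_) (range (suc e) (length π))

descentsBelow : List ℕ → ℕ → List ℕ
descentsBelow π d = filter (isDescent? π) (consecutive 1 (d ∸ 1))

descentsAbove : List ℕ → ℕ → List ℕ
descentsAbove π d = filter (isDescent? π) (consecutive (suc d) (length π ∸ d))

positions-split : ∀ π {d} m → 1 ≤ d → length π ≡ d + m →
  positions π ≡ consecutive 1 (d ∸ 1) ++ d ∷ consecutive (suc d) m
positions-split π {d} m 1≤d n≡d+m = begin
  positions π                                                ≡⟨ positions≡consecutive π ⟩
  consecutive 1 (length π)                                   ≡⟨ cong (consecutive 1) n≡[d∸1]+[1+m] ⟩
  consecutive 1 ((d ∸ 1) + suc m)                            ≡⟨ consecutive-++ 1 (d ∸ 1) (suc m) ⟩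
  consecutive 1 (d ∸ 1) ++ consecutive (1 + (d ∸ 1)) (suc m) ≡⟨ cong (λ a → consecutive 1 (d ∸ 1) ++ consecutive a (suc m)) 1+[d∸1]≡d ⟩
  consecutive 1 (d ∸ 1) ++ d ∷ consecutive (suc d) m         ∎
  where
  open ≡-Reasoning
  1+[d∸1]≡d : 1 + (d ∸ 1) ≡ d
  1+[d∸1]≡d = m+[n∸m]≡n 1≤d
  n≡[d∸1]+[1+m] : length π ≡ (d ∸ 1) + suc m
  n≡[d∸1]+[1+m] = trans n≡d+m (sym (trans (+-suc (d ∸ 1) m) (cong (_+ m) 1+[d∸1]≡d)))

descents-split : ∀ π {d} → IsDescent π d → descents π ≡ descentsBelow π d ++ d ∷ descentsAbove π d
descents-split π {d} desc@(1≤d , d<n , _) = begin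
  filter (isDescent? π) (positions π)
    ≡⟨ cong (filter (isDescent? π)) (positions-split π (length π ∸ d) 1≤d (sym (m+[n∸m]≡n (<⇒≤ d<n)))) ⟩
  filter (isDescent? π) (consecutive 1 (d ∸ 1) ++ d ∷ consecutive (suc d) (length π ∸ d))
    ≡⟨ filter-++ (isDescent? π) (consecutive 1 (d ∸ 1)) _ ⟩
  descentsBelow π d ++ filter (isDescent? π) (d ∷ consecutive (suc d) (length π ∸ d))
    ≡⟨ cong (descentsBelow π d ++_) (filter-accept (isDescent? π) desc) ⟩
  descentsBelow π d ++ d ∷ descentsAbove π d
    ∎
  where open ≡-Reasoning

numVHCThrough : List ℕ → ℕ → ℕ → ℕ
numVHCThrough π d k =
  sum (map (λ a → count (λ b → isVHC? π (a ++ (d , k) ∷ b)) (choices (map (hooksFrom π) (descentsAbove π d))))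
           (choices (map (hooksFrom π) (descentsBelow π d))))

numVHC≡sum-numVHCThrough : ∀ π {d} → IsDescent π d →
  numVHC π ≡ sum (map (numVHCThrough π d) (range (suc d) (length π)))
numVHC≡sum-numVHCThrough π {d} desc = begin
  count V (choices (map (hooksFrom π) (descents π)))
    ≡⟨ cong (count V ∘ choices ∘ map (hooksFrom π)) (descents-split π desc) ⟩
  count V (choices (map (hooksFrom π) (descentsBelow π d ++ d ∷ descentsAbove π d)))
    ≡⟨ cong (count V ∘ choices) (map-++ (hooksFrom π) (descentsBelow π d) _) ⟩
  count V (choices (before ++ hooksFrom π d ∷ under))
    ≡⟨ count-choices-++ V before (hooksFrom π d ∷ under) ⟩
  sum (map (λ a → count (V ∘ (a ++_)) (choices (hooksFrom π d ∷ under))) (choices before))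
    ≡⟨ sum-map-cong-∈ (choices before) (λ {a} _ → trans (count-choices-∷ (V ∘ (a ++_)) (hooksFrom π d) under)
         (sum-map-map (λ x → count (λ b → V (a ++ x ∷ b)) (choices under)) (d ,_) (range (suc d) (length π)))) ⟩
  sum (map (λ a → sum (map (λ k → count (λ b → V (a ++ (d , k) ∷ b)) (choices under)) (range (suc d) (length π))))
           (choices before))
    ≡⟨ sum-map-comm (λ a k → count (λ b → V (a ++ (d , k) ∷ b)) (choices under)) (choices before) (range (suc d) (length π)) ⟩
  sum (map (numVHCThrough π d) (range (suc d) (length π)))
    ∎
  where
  open ≡-Reasoning
  V = isVHC? π
  before = map (hooksFrom π) (descentsBelow π d)
  under = map (hooksFrom π) (descentsAbove π d)

numVHCThrough-nonHook : ∀ π {d k} → ¬ IsHook π (d , k) → numVHCThrough π d k ≡ 0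
numVHCThrough-nonHook π {d} {k} ¬hook = trans
  (sum-map-cong-∈ (choices (map (hooksFrom π) (descentsBelow π d)))
    (λ {a} _ → count-none (λ b → isVHC? π (a ++ (d , k) ∷ b)) (choices (map (hooksFrom π) (descentsAbove π d)))
      (λ _ (_ , hks , _) → ¬hook (All.head (All.++⁻ʳ a hks)))))
  (sum-map-const-0 (choices (map (hooksFrom π) (descentsBelow π d))))

-- A hook H = (d , j) from a tail-bound descent d

module TailBoundHook (π : List ℕ) (d : ℕ) (tb : TailBound π d) (j : ℕ) (hj : IsHook π (d , j)) where

  n : ℕ
  n = length π

  H : Hook
  H = d , j

  1≤d : 1 ≤ d
  1≤d = proj₁ (proj₁ tb)

  d<j : d < j
  d<j = proj₁ (proj₂ hj)

  j≤n : j ≤ n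
  j≤n = proj₁ (proj₂ (proj₂ hj))

  πd<πj : at π d < at π j
  πd<πj = proj₂ (proj₂ (proj₂ hj))

  d≤n : d ≤ n
  d≤n = ≤-trans (<⇒≤ d<j) j≤n

  hook-in-tail : ∀ {k} → IsHook π (d , k) → InTail π k
  hook-in-tail hk@(_ , d<k , k≤n , _) =
    All.lookup (proj₂ tb) (∈-filter⁺ (isHook? π) (∈-map⁺ (d ,_) (∈-range⁺ d<k k≤n)) hk)

  fixed-from-j : ∀ {k} → j ≤ k → k ≤ n → at π k ≡ k
  fixed-from-j j≤k k≤n = InTail⇒fixed π (<-≤-trans (proj₁ (hook-in-tail hj)) j≤k , k≤n)

  πj≡j : at π j ≡ j
  πj≡j = fixed-from-j ≤-refl j≤n

  -- If π_x > π_d then (d , x) is a hook, so x lies in the tail and π_x = x < j = π_j.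
  below-roof : ∀ {x} → d < x → x < j → at π x < at π j
  below-roof {x} d<x x<j with at π d <? at π x
  ... | yes πd<πx = subst₂ _<_ (sym (InTail⇒fixed π (hook-in-tail hk))) (sym πj≡j) x<j
    where hk = 1≤d , d<x , ≤-trans (<⇒≤ x<j) j≤n , πd<πx
  ... | no πd≮πx = ≤-<-trans (≮⇒≥ πd≮πx) πd<πj

  nothingAbove-H : NothingAbove′ π H
  nothingAbove-H x d≤x x≤j with m≤n⇒m<n∨m≡n d≤x | m≤n⇒m<n∨m≡n x≤j
  ... | inj₂ refl | _         = <⇒≤ πd<πj
  ... | inj₁ _    | inj₂ refl = ≤-refl
  ... | inj₁ d<x  | inj₁ x<j  = <⇒≤ (below-roof d<x x<j)

  above-roof : ∀ {k} → j < k → k ≤ n → at π j < at π k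
  above-roof j<k k≤n = subst₂ _<_ (sym πj≡j) (sym (fixed-from-j (<⇒≤ j<k) k≤n)) j<k

  above-roof-≤ : ∀ {k} → j ≤ k → k ≤ n → at π j ≤ at π k
  above-roof-≤ j≤k k≤n = subst₂ _≤_ (sym πj≡j) (sym (fixed-from-j j≤k k≤n)) j≤k

  δ : ℕ
  δ = j ∸ d

  d+δ≡j : d + δ ≡ j
  d+δ≡j = m+[n∸m]≡n (<⇒≤ d<j)

  L : ℕ
  L = j ∸ suc d

  1+d+L≡j : suc (d + L) ≡ j
  1+d+L≡j = m+[n∸m]≡n d<j

  U : List ℕ
  U = unsheltered π H

  S : List ℕ
  S = sheltered π H

  length-take-d : length (take d π) ≡ d
  length-take-d = trans (length-take d π) (m≤n⇒m⊓n≡m d≤n)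

  length-U : length U ≡ d + (n ∸ j)
  length-U = trans (length-++ (take d π)) (cong₂ _+_ length-take-d (length-drop j π))

  length-S : length S ≡ L
  length-S = trans (length-take L (drop d π))
    (m≤n⇒m⊓n≡m (subst (L ≤_) (sym (length-drop d π)) (∸-monoˡ-≤ (suc d) (m≤n⇒m≤1+n j≤n))))

  d≤length-U : d ≤ length U
  d≤length-U = subst (d ≤_) (sym length-U) (m≤m+n d _)

  length-U+δ≡n : length U + δ ≡ n
  length-U+δ≡n = begin
    length U + δ          ≡⟨ cong (_+ δ) length-U ⟩
    d + (n ∸ j) + δ       ≡⟨ +-assoc d _ δ ⟩
    d + ((n ∸ j) + δ)     ≡⟨ cong (d +_) (+-comm (n ∸ j) δ) ⟩
    d + (δ + (n ∸ j))     ≡⟨ +-assoc d δ _ ⟨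
    d + δ + (n ∸ j)       ≡⟨ cong (_+ (n ∸ j)) d+δ≡j ⟩
    j + (n ∸ j)           ≡⟨ m+[n∸m]≡n j≤n ⟩
    n                     ∎
    where open ≡-Reasoning

  -- σU x is the position in π of the x-th letter of U.
  σU : ℕ → ℕ
  σU x with x ≤? d
  ... | yes _ = x
  ... | no _  = x + δ

  σU-≤ : ∀ {x} → x ≤ d → σU x ≡ x
  σU-≤ {x} x≤d with x ≤? d
  ... | yes _   = refl
  ... | no x≰d = ⊥-elim (x≰d x≤d)

  σU-> : ∀ {x} → d < x → σU x ≡ x + δ
  σU-> {x} d<x with x ≤? d
  ... | yes x≤d = ⊥-elim (<⇒≱ d<x x≤d)
  ... | no _    = refl

  σU-cases : ∀ x → (x ≤ d × σU x ≡ x) ⊎ (d < x × σU x ≡ x + δ)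
  σU-cases x with ≤-<-connex x d
  ... | inj₁ x≤d = inj₁ (x≤d , σU-≤ x≤d)
  ... | inj₂ d<x = inj₂ (d<x , σU-> d<x)

  σU-mono : ∀ {x y} → x ≤ y → σU x ≤ σU y
  σU-mono {x} {y} x≤y with σU-cases x | σU-cases y
  ... | inj₁ (_ , ex)   | inj₁ (_ , ey)   = subst₂ _≤_ (sym ex) (sym ey) x≤y
  ... | inj₁ (_ , ex)   | inj₂ (_ , ey)   = subst₂ _≤_ (sym ex) (sym ey) (≤-trans x≤y (m≤m+n y δ))
  ... | inj₂ (d<x , _)  | inj₁ (y≤d , _)  = ⊥-elim (<⇒≱ d<x (≤-trans x≤y y≤d))
  ... | inj₂ (_ , ex)   | inj₂ (_ , ey)   = subst₂ _≤_ (sym ex) (sym ey) (+-monoˡ-≤ δ x≤y)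

  σU-cancel : ∀ {x y} → σU x ≤ σU y → x ≤ y
  σU-cancel {x} {y} σx≤σy with σU-cases x | σU-cases y
  ... | inj₁ (_ , ex)   | inj₁ (_ , ey)   = subst₂ _≤_ ex ey σx≤σy
  ... | inj₁ (x≤d , _)  | inj₂ (d<y , _)  = ≤-trans x≤d (<⇒≤ d<y)
  ... | inj₂ (d<x , ex) | inj₁ (y≤d , ey) =
    ⊥-elim (<⇒≱ d<x (≤-trans (m≤m+n x δ) (≤-trans (subst₂ _≤_ ex ey σx≤σy) y≤d)))
  ... | inj₂ (_ , ex)   | inj₂ (_ , ey)   = +-cancelʳ-≤ δ x y (subst₂ _≤_ ex ey σx≤σy)

  σU-pos : ∀ {x} → 1 ≤ x → 1 ≤ σU x
  σU-pos {x} 1≤x = ≤-trans 1≤x (σU-inflationary x)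
    where
    σU-inflationary : ∀ x → x ≤ σU x
    σU-inflationary x with σU-cases x
    ... | inj₁ (_ , e) = ≤-reflexive (sym e)
    ... | inj₂ (_ , e) = subst (x ≤_) (sym e) (m≤m+n x δ)

  σU-bound : ∀ {x} → x ≤ length U → σU x ≤ n
  σU-bound {x} x≤ with σU-cases x
  ... | inj₁ (x≤d , e) = subst (_≤ n) (sym e) (≤-trans x≤d d≤n)
  ... | inj₂ (_ , e)   = subst (_≤ n) (sym e) (subst (x + δ ≤_) length-U+δ≡n (+-monoˡ-≤ δ x≤))

  at-σU : ∀ {x} → 1 ≤ x → x ≤ length U → at U x ≡ at π (σU x)
  at-σU {x} 1≤x x≤ with σU-cases x
  ... | inj₁ (x≤d , e) = begin
    at (take d π ++ drop j π) x   ≡⟨ at-++ˡ (take d π) (drop j π) (subst (x ≤_) (sym length-take-d) x≤d) ⟩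
    at (take d π) x               ≡⟨ at-take π d x≤d ⟩
    at π x                        ≡⟨ cong (at π) e ⟨
    at π (σU x)                   ∎
    where open ≡-Reasoning
  ... | inj₂ (d<x , e) = begin
    at (take d π ++ drop j π) x                  ≡⟨ cong (at U) d+y≡x ⟨
    at (take d π ++ drop j π) (d + y)            ≡⟨ cong (λ l → at U (l + y)) length-take-d ⟨
    at (take d π ++ drop j π) (length (take d π) + y) ≡⟨ at-++ʳ (take d π) (drop j π) 1≤y ⟩
    at (drop j π) y                              ≡⟨ at-drop π j 1≤y ⟩
    at π (j + y)                                 ≡⟨ cong (at π) j+y≡σx ⟩
    at π (σU x)                                  ∎
    where
    open ≡-Reasoning
    y = x ∸ d
    d+y≡x : d + y ≡ x
    d+y≡x = m+[n∸m]≡n (<⇒≤ d<x)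
    1≤y : 1 ≤ y
    1≤y = m<n⇒0<n∸m d<x
    j+y≡σx : j + y ≡ σU x
    j+y≡σx = begin
      j + y         ≡⟨ cong (_+ y) d+δ≡j ⟨
      d + δ + y     ≡⟨ +-assoc d δ y ⟩
      d + (δ + y)   ≡⟨ cong (d +_) (+-comm δ y) ⟩
      d + (y + δ)   ≡⟨ +-assoc d y δ ⟨
      d + y + δ     ≡⟨ cong (_+ δ) d+y≡x ⟩
      x + δ         ≡⟨ e ⟨
      σU x          ∎

  module RU = Relabelling U π σU σU-mono σU-cancel σU-pos σU-bound at-σU

  σS : ℕ → ℕ
  σS = d +_

  σS-bound : ∀ {x} → x ≤ length S → σS x ≤ n
  σS-bound {x} x≤ = ≤-trans (+-monoʳ-≤ d (subst (x ≤_) length-S x≤))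
    (≤-trans (n≤1+n (d + L)) (subst (_≤ n) (sym 1+d+L≡j) j≤n))

  at-σS : ∀ {x} → 1 ≤ x → x ≤ length S → at S x ≡ at π (σS x)
  at-σS {x} 1≤x x≤ = trans (at-take (drop d π) L (subst (x ≤_) length-S x≤)) (at-drop π d 1≤x)

  module RS = Relabelling S π σS (+-monoʳ-≤ d) (+-cancelˡ-≤ d _ _) (λ {x} 1≤x → ≤-trans 1≤x (m≤n+m x d)) σS-bound at-σS

  at-U-≤ : ∀ {x} → 1 ≤ x → x ≤ d → at U x ≡ at π x
  at-U-≤ 1≤x x≤d = trans (at-σU 1≤x (≤-trans x≤d d≤length-U)) (cong (at π) (σU-≤ x≤d))

  at-U-> : ∀ {x} → d < x → x ≤ length U → at U x ≡ x + δ
  at-U-> {x} d<x x≤ = begin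
    at U x          ≡⟨ at-σU (≤-trans (s≤s z≤n) d<x) x≤ ⟩
    at π (σU x)     ≡⟨ cong (at π) (σU-> d<x) ⟩
    at π (x + δ)    ≡⟨ fixed-from-j (subst (_≤ x + δ) d+δ≡j (+-monoˡ-≤ δ (<⇒≤ d<x))) (subst (_≤ n) (σU-> d<x) (σU-bound x≤)) ⟩
    x + δ           ∎
    where open ≡-Reasoning

  no-descent-from-j : ∀ {e} → j ≤ e → ¬ IsDescent π e
  no-descent-from-j {e} j≤e (_ , e<n , π[1+e]<πe) = <-asym π[1+e]<πe
    (subst₂ _<_ (sym (fixed-from-j j≤e (<⇒≤ e<n))) (sym (fixed-from-j (m≤n⇒m≤1+n j≤e) e<n)) (n<1+n e))

  descent-U⇔-below : ∀ {e} → e ∈ consecutive 1 (d ∸ 1) → IsDescent U e ⇔ IsDescent π e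
  descent-U⇔-below {e} e∈ with ∈-consecutive⁻ e∈
  ... | 1≤e , e<1+[d∸1] = mk⇔
    (λ (1≤e , _ , lt) → 1≤e , <-≤-trans e<d d≤n , subst₂ _<_ (at-U-≤ z<s e<d) (at-U-≤ 1≤e (<⇒≤ e<d)) lt)
    (λ (1≤e , _ , lt) → 1≤e , <-≤-trans e<d d≤length-U , subst₂ _<_ (sym (at-U-≤ z<s e<d)) (sym (at-U-≤ 1≤e (<⇒≤ e<d))) lt)
    where
    e<d : e < d
    e<d = subst (e <_) (m+[n∸m]≡n 1≤d) e<1+[d∸1]

  no-descent-U-at-d : ¬ IsDescent U d
  no-descent-U-at-d (_ , d<|U| , lt) = <-asym lt (begin-strict
    at U d               ≡⟨ at-U-≤ 1≤d ≤-refl ⟩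
    at π d               <⟨ πd<πj ⟩
    at π j               ≡⟨ πj≡j ⟩
    j                    <⟨ n<1+n j ⟩
    suc j                ≡⟨ cong suc d+δ≡j ⟨
    suc d + δ            ≡⟨ at-U-> (n<1+n d) d<|U| ⟨
    at U (suc d)         ∎)
    where open ≤-Reasoning

  no-descent-U-above-d : ∀ {e} → e ∈ consecutive (suc d) (n ∸ j) → ¬ IsDescent U e
  no-descent-U-above-d e∈ (_ , e<|U| , lt) with ∈-consecutive⁻ e∈
  ... | d<e , _ = <-asym lt (subst₂ _<_ (sym (at-U-> d<e (<⇒≤ e<|U|))) (sym (at-U-> (m<n⇒m<1+n d<e) e<|U|)) (n<1+n _))

  descents-U : descents U ≡ descentsBelow π d
  descents-U = begin
    filter (isDescent? U) (positions U)
      ≡⟨ cong (filter (isDescent? U)) (positions-split U (n ∸ j) 1≤d length-U) ⟩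
    filter (isDescent? U) (consecutive 1 (d ∸ 1) ++ d ∷ consecutive (suc d) (n ∸ j))
      ≡⟨ filter-++ (isDescent? U) (consecutive 1 (d ∸ 1)) _ ⟩
    filter (isDescent? U) (consecutive 1 (d ∸ 1)) ++ filter (isDescent? U) (d ∷ consecutive (suc d) (n ∸ j))
      ≡⟨ cong₂ _++_ (filter-cong-∈ (isDescent? U) (isDescent? π) _ descent-U⇔-below)
                    (trans (filter-reject (isDescent? U) no-descent-U-at-d) (filter-none (isDescent? U) (All.tabulate no-descent-U-above-d))) ⟩
    descentsBelow π d ++ []
      ≡⟨ ++-identityʳ _ ⟩
    descentsBelow π d
      ∎
    where open ≡-Reasoning

  descent-S⇔ : ∀ {e} → e ∈ consecutive 1 L → IsDescent π (σS e) ⇔ IsDescent S e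
  descent-S⇔ {e} e∈ = mk⇔ to′ from′
    where
    1≤e = proj₁ (∈-consecutive⁻ e∈)
    e<1+L = proj₂ (∈-consecutive⁻ e∈)
    at-S-e : e ≤ L → at S e ≡ at π (d + e)
    at-S-e e≤L = at-σS 1≤e (subst (e ≤_) (sym length-S) e≤L)
    at-S-1+e : e < L → at S (suc e) ≡ at π (suc (d + e))
    at-S-1+e e<L = trans (at-σS z<s (subst (suc e ≤_) (sym length-S) e<L)) (cong (at π) (+-suc d e))
    to′ : IsDescent π (d + e) → IsDescent S e
    to′ (_ , _ , lt) with m≤n⇒m<n∨m≡n (≤-pred e<1+L)
    ... | inj₁ e<L = 1≤e , subst (e <_) (sym length-S) e<L , subst₂ _<_ (sym (at-S-1+e e<L)) (sym (at-S-e (<⇒≤ e<L))) lt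
    ... | inj₂ refl = ⊥-elim (<-asym lt (subst (λ x → at π (d + L) < at π x) (sym 1+d+L≡j)
                        (below-roof (m<m+n d 1≤e) (subst (d + L <_) 1+d+L≡j (n<1+n _)))))
    from′ : IsDescent S e → IsDescent π (d + e)
    from′ (_ , e<|S| , lt) =
      ≤-trans 1≤e (m≤n+m e d) , <-≤-trans (+-monoʳ-< d e<L) (≤-trans (n≤1+n _) (subst (_≤ n) (sym 1+d+L≡j) j≤n)) ,
      subst₂ _<_ (at-S-1+e e<L) (at-S-e (<⇒≤ e<L)) lt
      where e<L = subst (e <_) length-S e<|S|

  descentsAbove≡ : descentsAbove π d ≡ map σS (descents S)
  descentsAbove≡ = begin
    filter (isDescent? π) (consecutive (suc d) (suc n ∸ suc d))
      ≡⟨ cong (filter (isDescent? π)) (consecutive-split d<j (m≤n⇒m≤1+n j≤n)) ⟩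
    filter (isDescent? π) (consecutive (suc d) L ++ consecutive j (suc n ∸ j))
      ≡⟨ filter-++ (isDescent? π) (consecutive (suc d) L) _ ⟩
    filter (isDescent? π) (consecutive (suc d) L) ++ filter (isDescent? π) (consecutive j (suc n ∸ j))
      ≡⟨ cong₂ _++_ (cong (filter (isDescent? π)) [1+d⋯]≡σS[1⋯])
                    (filter-none (isDescent? π) (All.tabulate (no-descent-from-j ∘ proj₁ ∘ ∈-consecutive⁻ {j} {suc n ∸ j}))) ⟩
    filter (isDescent? π) (map σS (consecutive 1 L)) ++ []
      ≡⟨ ++-identityʳ _ ⟩
    filter (isDescent? π) (map σS (consecutive 1 L))
      ≡⟨ filter-map (isDescent? π) σS (consecutive 1 L) ⟩
    map σS (filter (isDescent? π ∘ σS) (consecutive 1 L))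
      ≡⟨ cong (map σS) (filter-cong-∈ (isDescent? π ∘ σS) (isDescent? S) _ descent-S⇔) ⟩
    map σS (filter (isDescent? S) (consecutive 1 L))
      ≡⟨ cong (map σS ∘ filter (isDescent? S)) (trans (cong (consecutive 1) (sym length-S)) (sym (positions≡consecutive S))) ⟩
    map σS (descents S)
      ∎
    where
    open ≡-Reasoning
    [1+d⋯]≡σS[1⋯] : consecutive (suc d) L ≡ map σS (consecutive 1 L)
    [1+d⋯]≡σS[1⋯] = trans (cong (λ a → consecutive a L) (+-comm 1 d)) (sym (map-+-consecutive d 1 L))

  EndsOutsideH : Hook → Set
  EndsOutsideH (_ , k) = k ≤ d ⊎ j < k

  endsOutsideH? : Decidable EndsOutsideH
  endsOutsideH? (_ , k) = (k ≤? d) ⊎-dec (j <? k)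

  τU : ℕ → ℕ
  τU k with k ≤? d
  ... | yes _ = k
  ... | no _  = k ∸ δ

  τU-≤ : ∀ {k} → k ≤ d → τU k ≡ k
  τU-≤ {k} k≤d with k ≤? d
  ... | yes _   = refl
  ... | no k≰d = ⊥-elim (k≰d k≤d)

  τU-> : ∀ {k} → d < k → τU k ≡ k ∸ δ
  τU-> {k} d<k with k ≤? d
  ... | yes k≤d = ⊥-elim (<⇒≱ d<k k≤d)
  ... | no _    = refl

  d<k∸δ : ∀ {k} → j < k → d < k ∸ δ
  d<k∸δ j<k = subst (_< _ ∸ δ) (m∸[m∸n]≡n (<⇒≤ d<j)) (∸-monoˡ-< j<k (m∸n≤m j d))

  k∸δ+δ≡k : ∀ {k} → j < k → k ∸ δ + δ ≡ k
  k∸δ+δ≡k j<k = m∸n+n≡m (≤-trans (m∸n≤m j d) (<⇒≤ j<k))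

  σU-τU : ∀ k → k ≤ d ⊎ j < k → σU (τU k) ≡ k
  σU-τU _ (inj₁ k≤d) = trans (cong σU (τU-≤ k≤d)) (σU-≤ k≤d)
  σU-τU _ (inj₂ j<k) = trans (cong σU (τU-> (<-trans d<j j<k))) (trans (σU-> (d<k∸δ j<k)) (k∸δ+δ≡k j<k))

  d<τU : ∀ {k} → j < k → d < τU k
  d<τU j<k = subst (d <_) (sym (τU-> (<-trans d<j j<k))) (d<k∸δ j<k)

  toU : Hook → Hook
  toU (e , k) = e , τU k

  relabel-toU : ∀ {e k} → e ≤ d → EndsOutsideH (e , k) → RU.relabel (toU (e , k)) ≡ (e , k)
  relabel-toU {k = k} e≤d outside = cong₂ _,_ (σU-≤ e≤d) (σU-τU k outside)

  withinBounds-toU : ∀ {e k} → 1 ≤ e → k ≤ n → EndsOutsideH (e , k) → WithinBounds U (toU (e , k))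
  withinBounds-toU 1≤e k≤n (inj₁ k≤d) = 1≤e , subst (_≤ length U) (sym (τU-≤ k≤d)) (≤-trans k≤d d≤length-U)
  withinBounds-toU 1≤e k≤n (inj₂ j<k) = 1≤e , subst₂ _≤_ (sym (τU-> (<-trans d<j j<k))) n∸δ≡length-U (∸-monoˡ-≤ δ k≤n)
    where
    n∸δ≡length-U : n ∸ δ ≡ length U
    n∸δ≡length-U = trans (cong (_∸ δ) (sym length-U+δ≡n)) (m+n∸n≡m (length U) δ)

  -- Otherwise its roof would cross the vertical segment of H at column d.
  endsOutsideH : ∀ {e k} → e ≤ d → NothingAbove′ π (e , k) → Compatible′ π (e , k) H → EndsOutsideH (e , k)
  endsOutsideH {e} {k} e≤d noneAbove compat with ≤-<-connex k d | <-≤-connex j k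
  ... | inj₁ k≤d | _        = inj₁ k≤d
  ... | inj₂ _   | inj₁ j<k = inj₂ j<k
  ... | inj₂ d<k | inj₂ k≤j = ⊥-elim (not-joint (compat (d , at π k)
          (inj₂ (e≤d , <⇒≤ d<k , refl)) (inj₁ (refl , noneAbove d e≤d (<⇒≤ d<k) , nothingAbove-H k (<⇒≤ d<k) k≤j))))
    where
    not-joint : ¬ Joint π (e , k) H (d , at π k)
    not-joint (inj₁ (d,πk≡ne , _)) = <⇒≢ d<k (proj₁ (×-≡,≡←≡ d,πk≡ne))
    not-joint (inj₂ (d,πk≡ne , _)) = <⇒≢ d<j (proj₁ (×-≡,≡←≡ d,πk≡ne))

  below-hook⇒ : ∀ {e k} → e < d → IsHook π (e , k) → NothingAbove π (e , k) → Compatible π (e , k) H →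
    EndsOutsideH (e , k) × IsHook U (toU (e , k)) × NothingAbove U (toU (e , k))
  below-hook⇒ {e} {k} e<d hk@(1≤e , _ , k≤n , _) noneAbove compat =
    outside ,
    RU.isHook⁻ (toU (e , k)) bounds (subst (IsHook π) (sym relabel≡) hk) ,
    NothingAbove′⇒ U (toU (e , k)) (RU.nothingAbove⁻ (toU (e , k)) bounds (subst (NothingAbove′ π) (sym relabel≡) noneAbove′))
    where
    noneAbove′ = NothingAbove⇒′ π (e , k) hk noneAbove
    outside = endsOutsideH (<⇒≤ e<d) noneAbove′ (Compatible⇒′ π (e , k) H compat)
    bounds = withinBounds-toU 1≤e k≤n outside
    relabel≡ = relabel-toU (<⇒≤ e<d) outside

  σU-onto : ∀ {x′} → x′ ≤ d ⊎ j < x′ → Σ[ x ∈ ℕ ] x′ ≡ σU x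
  σU-onto {x′} outside = τU x′ , sym (σU-τU x′ outside)

  compatible-H-from-below : ∀ {e k} → e < d → k ≤ n → EndsOutsideH (e , k) → Compatible′ π (e , k) H
  compatible-H-from-below e<d _ _ _ (inj₁ (refl , _)) on-H = ⊥-elim (<⇒≱ e<d (onHook-col≥ π on-H))
  compatible-H-from-below e<d k≤n (inj₂ j<k) _ (inj₂ (_ , _ , refl)) on-H =
    ⊥-elim (<⇒≱ (above-roof j<k k≤n) (onHook-row≤ π on-H))
  compatible-H-from-below e<d k≤n (inj₁ k≤d) _ (inj₂ (_ , d≤k , refl)) (inj₁ (refl , _)) with ≤-antisym k≤d d≤k
  ... | refl = inj₁ (refl , refl)
  compatible-H-from-below e<d k≤n (inj₁ k≤d) _ (inj₂ (_ , x≤k , refl)) (inj₂ (d≤x , _ , πk≡πj)) =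
    ⊥-elim (<⇒≢ πd<πj (trans (cong (at π) (≤-antisym (≤-trans d≤x x≤k) k≤d)) πk≡πj))

  below-hook⇐ : ∀ {e k} → e < d → EndsOutsideH (e , k) → IsHook U (toU (e , k)) → NothingAbove U (toU (e , k)) →
    IsHook π (e , k) × NothingAbove π (e , k) × Compatible π (e , k) H
  below-hook⇐ {e} {k} e<d outside hkU noneAboveU =
    hk ,
    NothingAbove′⇒ π (e , k) (subst (NothingAbove′ π) relabel≡
      (RU.nothingAbove⁺ (toU (e , k)) hkU (NothingAbove⇒′ U (toU (e , k)) hkU noneAboveU) skipped)) ,
    Compatible′⇒ π (e , k) H (compatible-H-from-below e<d k≤n outside)
    where
    relabel≡ = relabel-toU (<⇒≤ e<d) outside
    hk = subst (IsHook π) relabel≡ (RU.isHook⁺ (toU (e , k)) hkU)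
    k≤n = proj₁ (proj₂ (proj₂ hk))
    skipped : ∀ x′ → σU e ≤ x′ → x′ ≤ σU (τU k) → (Σ[ x ∈ ℕ ] x′ ≡ σU x) ⊎ at π x′ ≤ at π (σU (τU k))
    skipped x′ _ x′≤σU[τU[k]] with ≤-<-connex x′ d | <-≤-connex j x′
    ... | inj₁ x′≤d | _         = inj₁ (σU-onto (inj₁ x′≤d))
    ... | inj₂ _    | inj₁ j<x′ = inj₁ (σU-onto (inj₂ j<x′))
    ... | inj₂ d<x′ | inj₂ x′≤j = inj₂ (subst (at π x′ ≤_) (cong (at π) (sym (σU-τU k outside))) (below-πk outside))
      where
      below-πk : EndsOutsideH (e , k) → at π x′ ≤ at π k
      below-πk (inj₁ k≤d) = ⊥-elim (<⇒≱ d<x′ (≤-trans (subst (x′ ≤_) (σU-τU k outside) x′≤σU[τU[k]]) k≤d))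
      below-πk (inj₂ j<k) = ≤-trans (nothingAbove-H x′ (<⇒≤ d<x′) x′≤j) (<⇒≤ (above-roof j<k k≤n))

  roof-beyond-j : ∀ {e k x y} → e < d → EndsOutsideH (e , k) → d < x → OnHook π (e , k) (x , y) →
    j < k × y ≡ at π k
  roof-beyond-j e<d _          d<x (inj₁ (refl , _))      = ⊥-elim (<-asym e<d d<x)
  roof-beyond-j e<d (inj₁ k≤d) d<x (inj₂ (_ , x≤k , _))   = ⊥-elim (<⇒≱ d<x (≤-trans x≤k k≤d))
  roof-beyond-j e<d (inj₂ j<k) d<x (inj₂ (_ , _ , y≡πk)) = j<k , y≡πk

  fixed-injective : ∀ {k k′} → j < k → k ≤ n → j < k′ → k′ ≤ n → at π k ≡ at π k′ → k ≡ k′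
  fixed-injective j<k k≤n j<k′ k′≤n πk≡πk′ =
    trans (sym (fixed-from-j (<⇒≤ j<k) k≤n)) (trans πk≡πk′ (fixed-from-j (<⇒≤ j<k′) k′≤n))

  -- Their common northeast endpoint lies right of d in U, so it is the southwest endpoint of neither.
  same-end-incompatible : ∀ {e e′ k} → e < d → e′ < d → j < k → IsHook U (toU (e , k)) → IsHook U (toU (e′ , k)) →
    ¬ Compatible′ U (toU (e , k)) (toU (e′ , k))
  same-end-incompatible {k = k} e<d e′<d j<k (_ , e<τUk , _) (_ , e′<τUk , _) compat
    with compat (τU k , at U (τU k)) (inj₂ (<⇒≤ e<τUk , ≤-refl , refl)) (inj₂ (<⇒≤ e′<τUk , ≤-refl , refl))
  ... | inj₁ (_ , q≡sw′) = <⇒≱ (<-trans e′<d (d<τU j<k)) (≤-reflexive (proj₁ (×-≡,≡←≡ q≡sw′)))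
  ... | inj₂ (_ , q≡sw)  = <⇒≱ (<-trans e<d (d<τU j<k)) (≤-reflexive (proj₁ (×-≡,≡←≡ q≡sw)))

  below-meeting-in-image : ∀ {e k e′ k′} → e < d → e′ < d → EndsOutsideH (e , k) → EndsOutsideH (e′ , k′) →
    k ≤ n → k′ ≤ n → IsHook U (toU (e , k)) → IsHook U (toU (e′ , k′)) → Compatible′ U (toU (e , k)) (toU (e′ , k′)) →
    ∀ p → OnHook π (e , k) p → OnHook π (e′ , k′) p → Σ[ x ∈ ℕ ] proj₁ p ≡ σU x
  below-meeting-in-image e<d e′<d outside outside′ k≤n k′≤n hk hk′ compat (x , y) on-h on-h′
    with ≤-<-connex x d | <-≤-connex j x
  ... | inj₁ x≤d | _        = σU-onto (inj₁ x≤d)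
  ... | inj₂ _   | inj₁ j<x = σU-onto (inj₂ j<x)
  ... | inj₂ d<x | inj₂ _
    with roof-beyond-j e<d outside d<x on-h | roof-beyond-j e′<d outside′ d<x on-h′
  ...   | j<k , y≡πk | j<k′ , y≡πk′ with fixed-injective j<k k≤n j<k′ k′≤n (trans (sym y≡πk) y≡πk′)
  ...     | refl = ⊥-elim (same-end-incompatible e<d e′<d j<k hk hk′ compat)

  below-pair⇔ : ∀ {e k e′ k′} → e < d → e′ < d → EndsOutsideH (e , k) → EndsOutsideH (e′ , k′) →
    IsHook U (toU (e , k)) → IsHook U (toU (e′ , k′)) →
    Compatible π (e , k) (e′ , k′) ⇔ Compatible U (toU (e , k)) (toU (e′ , k′))
  below-pair⇔ {e} {k} {e′} {k′} e<d e′<d outside outside′ hk hk′ = mk⇔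
    (λ c → Compatible′⇒ U h h′ (RU.compatible⁻ h h′ hk hk′
             (subst₂ (Compatible′ π) (sym relabel≡) (sym relabel≡′) (Compatible⇒′ π (e , k) (e′ , k′) c))))
    (λ c → let c′ = Compatible⇒′ U h h′ c in
           Compatible′⇒ π (e , k) (e′ , k′) (subst₂ (Compatible′ π) relabel≡ relabel≡′
             (RU.compatible⁺ h h′ hk hk′ c′ (λ p on-h on-h′ →
               below-meeting-in-image e<d e′<d outside outside′ (end≤n relabel≡ hk) (end≤n relabel≡′ hk′) hk hk′ c′ p
                 (subst (λ h → OnHook π h p) relabel≡ on-h) (subst (λ h → OnHook π h p) relabel≡′ on-h′)))))
    where
    h = toU (e , k)
    h′ = toU (e′ , k′)
    relabel≡ = relabel-toU (<⇒≤ e<d) outside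
    relabel≡′ = relabel-toU (<⇒≤ e′<d) outside′
    end≤n : ∀ {h x} → RU.relabel h ≡ x → IsHook U h → proj₂ x ≤ n
    end≤n {h} refl hkU = proj₁ (proj₂ (proj₂ (RU.isHook⁺ h hkU)))

  EndsInsideH : Hook → Set
  EndsInsideH (_ , k) = k < j

  endsInsideH? : Decidable EndsInsideH
  endsInsideH? (_ , k) = k <? j

  toS : Hook → Hook
  toS (e , k) = e ∸ d , k ∸ d

  relabel-toS : ∀ {e k} → d ≤ e → d ≤ k → RS.relabel (toS (e , k)) ≡ (e , k)
  relabel-toS d≤e d≤k = cong₂ _,_ (m+[n∸m]≡n d≤e) (m+[n∸m]≡n d≤k)

  withinBounds-toS : ∀ {e k} → d < e → k < j → WithinBounds S (toS (e , k))
  withinBounds-toS {e} {k} d<e k<j = m<n⇒0<n∸m d<e ,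
    subst (k ∸ d ≤_) (trans (m+n∸m≡n d L) (sym length-S)) (∸-monoˡ-≤ d (≤-pred (subst (k <_) (sym 1+d+L≡j) k<j)))

  d<k-of-toS : ∀ {e k} → IsHook S (toS (e , k)) → d < k
  d<k-of-toS {e} (_ , e∸d<k∸d , _) = m∸n≢0⇒n<m (λ k∸d≡0 → n≮0 (subst (e ∸ d <_) k∸d≡0 e∸d<k∸d))

  σS-onto : ∀ {x′} → d ≤ x′ → Σ[ x ∈ ℕ ] x′ ≡ σS x
  σS-onto {x′} d≤x′ = x′ ∸ d , sym (m+[n∸m]≡n d≤x′)

  -- Otherwise H's roof would cross its vertical segment.
  endsInsideH : ∀ {e k} → d < e → e < j → IsHook π (e , k) → Compatible′ π H (e , k) → EndsInsideH (e , k)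
  endsInsideH {e} {k} d<e e<j (_ , e<k , k≤n , _) compat with <-≤-connex k j
  ... | inj₁ k<j = k<j
  ... | inj₂ j≤k = ⊥-elim (not-joint (compat (e , at π j)
          (inj₂ (<⇒≤ d<e , <⇒≤ e<j , refl)) (inj₁ (refl , <⇒≤ (below-roof d<e e<j) , above-roof-≤ j≤k k≤n))))
    where
    not-joint : ¬ Joint π H (e , k) (e , at π j)
    not-joint (inj₁ (e,πj≡ne , _)) = <⇒≢ e<j (proj₁ (×-≡,≡←≡ e,πj≡ne))
    not-joint (inj₂ (e,πj≡ne , _)) = <⇒≢ e<k (proj₁ (×-≡,≡←≡ e,πj≡ne))

  -- Right of d, H consists of its roof at height π_j, which every hook ending before j stays below.
  compatible-H-from-above : ∀ {e k} → d < e → IsHook π (e , k) → EndsInsideH (e , k) → Compatible′ π H (e , k)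
  compatible-H-from-above {e} {k} d<e (_ , e<k , _) k<j (x , y) on-H on-hk =
    ⊥-elim (not-on-roof on-H (<-≤-trans d<e (onHook-col≥ π on-hk)))
    where
    not-on-roof : OnHook π H (x , y) → d < x → ⊥
    not-on-roof (inj₁ (refl , _)) d<d = <-irrefl refl d<d
    not-on-roof (inj₂ (_ , _ , refl)) _ = <-irrefl refl (≤-<-trans (onHook-row≤ π on-hk) (below-roof (<-trans d<e e<k) k<j))

  above-hook⇒ : ∀ {e k} → d < e → e < j → IsHook π (e , k) → NothingAbove π (e , k) → Compatible π H (e , k) →
    EndsInsideH (e , k) × IsHook S (toS (e , k)) × NothingAbove S (toS (e , k))
  above-hook⇒ {e} {k} d<e e<j hk@(_ , e<k , _) noneAbove compat =
    inside ,
    RS.isHook⁻ (toS (e , k)) bounds (subst (IsHook π) (sym relabel≡) hk) ,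
    NothingAbove′⇒ S (toS (e , k)) (RS.nothingAbove⁻ (toS (e , k)) bounds
      (subst (NothingAbove′ π) (sym relabel≡) (NothingAbove⇒′ π (e , k) hk noneAbove)))
    where
    inside = endsInsideH d<e e<j hk (Compatible⇒′ π H (e , k) compat)
    bounds = withinBounds-toS d<e inside
    relabel≡ = relabel-toS (<⇒≤ d<e) (<⇒≤ (<-trans d<e e<k))

  above-hook⇐ : ∀ {e k} → d < e → EndsInsideH (e , k) → IsHook S (toS (e , k)) → NothingAbove S (toS (e , k)) →
    IsHook π (e , k) × NothingAbove π (e , k) × Compatible π H (e , k)
  above-hook⇐ {e} {k} d<e inside hkS noneAboveS =
    hk ,
    NothingAbove′⇒ π (e , k) (subst (NothingAbove′ π) relabel≡ (RS.nothingAbove⁺ (toS (e , k)) hkS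
      (NothingAbove⇒′ S (toS (e , k)) hkS noneAboveS)
      (λ x′ σS[e∸d]≤x′ _ → inj₁ (σS-onto (≤-trans (m≤m+n d _) σS[e∸d]≤x′))))) ,
    Compatible′⇒ π H (e , k) (compatible-H-from-above d<e hk inside)
    where
    relabel≡ = relabel-toS (<⇒≤ d<e) (<⇒≤ (d<k-of-toS hkS))
    hk = subst (IsHook π) relabel≡ (RS.isHook⁺ (toS (e , k)) hkS)

  above-pair⇔ : ∀ {e k e′ k′} → d < e → d < e′ → IsHook S (toS (e , k)) → IsHook S (toS (e′ , k′)) →
    Compatible π (e , k) (e′ , k′) ⇔ Compatible S (toS (e , k)) (toS (e′ , k′))
  above-pair⇔ {e} {k} {e′} {k′} d<e d<e′ hk hk′ = mk⇔
    (λ c → Compatible′⇒ S h h′ (RS.compatible⁻ h h′ hk hk′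
             (subst₂ (Compatible′ π) (sym relabel≡) (sym relabel≡′) (Compatible⇒′ π (e , k) (e′ , k′) c))))
    (λ c → Compatible′⇒ π (e , k) (e′ , k′) (subst₂ (Compatible′ π) relabel≡ relabel≡′
             (RS.compatible⁺ h h′ hk hk′ (Compatible⇒′ S h h′ c)
               (λ (x , _) on-h _ → σS-onto (≤-trans (m≤m+n d _) (onHook-col≥ π on-h))))))
    where
    h = toS (e , k)
    h′ = toS (e′ , k′)
    relabel≡ = relabel-toS (<⇒≤ d<e) (<⇒≤ (d<k-of-toS hk))
    relabel≡′ = relabel-toS (<⇒≤ d<e′) (<⇒≤ (d<k-of-toS hk′))

  -- Right of d, a hook before H runs above height π_j and a sheltered hook below it.
  below-above-compatible : ∀ {e k e′ k′} → e < d → EndsOutsideH (e , k) → IsHook π (e , k) →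
    d < e′ → EndsInsideH (e′ , k′) → IsHook π (e′ , k′) → Compatible π (e , k) (e′ , k′)
  below-above-compatible {e} {k} {e′} {k′} e<d outside (_ , _ , k≤n , _) d<e′ inside (_ , e′<k′ , _) =
    Compatible′⇒ π (e , k) (e′ , k′) λ (x , y) on-h on-h′ →
      ⊥-elim (separated outside on-h (<-≤-trans d<e′ (onHook-col≥ π on-h′))
        (≤-<-trans (onHook-row≤ π on-h′) (below-roof (<-trans d<e′ e′<k′) inside)))
    where
    separated : ∀ {x y} → EndsOutsideH (e , k) → OnHook π (e , k) (x , y) → d < x → y < at π j → ⊥
    separated _          (inj₁ (refl , _))       d<e _    = <-asym e<d d<e
    separated (inj₁ k≤d) (inj₂ (_ , x≤k , _))    d<x _    = <⇒≱ d<x (≤-trans x≤k k≤d)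
    separated (inj₂ j<k) (inj₂ (_ , _ , refl))   _   πk<πj = <-asym πk<πj (above-roof j<k k≤n)

  descentsBelow-< : ∀ {e} → e ∈ descentsBelow π d → e < d
  descentsBelow-< e∈ = subst (_ <_) (m+[n∸m]≡n 1≤d) (proj₂ (∈-consecutive⁻ {1} {d ∸ 1} (proj₁ (∈-filter⁻ (isDescent? π) {xs = consecutive 1 (d ∸ 1)} e∈))))

  descentsAbove-∈ : ∀ {e} → e ∈ descentsAbove π d → d < e × e < j
  descentsAbove-∈ {e} e∈ with ∈-filter⁻ (isDescent? π) {xs = consecutive (suc d) (n ∸ d)} e∈
  ... | e∈consecutive , desc = proj₁ (∈-consecutive⁻ {suc d} {n ∸ d} e∈consecutive) , ≰⇒> (λ j≤e → no-descent-from-j j≤e desc)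

  head-<d : ∀ {a : List Hook} {x} → map proj₁ a ≡ descentsBelow π d → x ∈ a → proj₁ x < d
  head-<d heads x∈ = descentsBelow-< (subst (_ ∈_) heads (∈-map⁺ proj₁ x∈))

  head-∈⟨d,j⟩ : ∀ {b : List Hook} {x} → map proj₁ b ≡ descentsAbove π d → x ∈ b → d < proj₁ x × proj₁ x < j
  head-∈⟨d,j⟩ heads x∈ = descentsAbove-∈ (subst (_ ∈_) heads (∈-map⁺ proj₁ x∈))

  ValidBeforeH : List Hook → Set
  ValidBeforeH a = All (IsHook π) a × All (NothingAbove π) a × AllPairs (Compatible π) a × All (λ x → Compatible π x H) a

  ValidUnderH : List Hook → Set
  ValidUnderH b = All (IsHook π) b × All (NothingAbove π) b × AllPairs (Compatible π) b × All (Compatible π H) b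

  ValidBeforeH⇔ : ∀ {a} → map proj₁ a ≡ descentsBelow π d →
    ValidBeforeH a ⇔ (All EndsOutsideH a × IsVHC U (map toU a))
  ValidBeforeH⇔ {a} heads = mk⇔
    (λ (hks , noneAboves , compats , compats-H) →
      let facts : ∀ {x} → x ∈ a → EndsOutsideH x × IsHook U (toU x) × NothingAbove U (toU x)
          facts x∈ = below-hook⇒ (lookup-< x∈) (All.lookup hks x∈) (All.lookup noneAboves x∈) (All.lookup compats-H x∈)
          pairFacts : All (λ x → proj₁ x < d × EndsOutsideH x × IsHook U (toU x)) a
          pairFacts = All.tabulate λ x∈ → lookup-< x∈ , proj₁ (facts x∈) , proj₁ (proj₂ (facts x∈))
      in All.tabulate (proj₁ ∘ facts) ,
         heads-U ,
         All.map⁺ (All.tabulate (proj₁ ∘ proj₂ ∘ facts)) ,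
         All.map⁺ (All.tabulate (proj₂ ∘ proj₂ ∘ facts)) ,
         AllPairs.map⁺ (AllPairs-map-local pairFacts
           (λ (e<d , out , hk) (e′<d , out′ , hk′) → to (below-pair⇔ e<d e′<d out out′ hk hk′)) compats))
    (λ (outs , _ , hksU , noneAbovesU , compatsU) →
      let hksU′ = All.map⁻ hksU
          facts : ∀ {x} → x ∈ a → IsHook π x × NothingAbove π x × Compatible π x H
          facts x∈ = below-hook⇐ (lookup-< x∈) (All.lookup outs x∈) (All.lookup hksU′ x∈) (All.lookup (All.map⁻ noneAbovesU) x∈)
          pairFacts : All (λ x → proj₁ x < d × EndsOutsideH x × IsHook U (toU x)) a
          pairFacts = All.tabulate λ x∈ → lookup-< x∈ , All.lookup outs x∈ , All.lookup hksU′ x∈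
      in All.tabulate (proj₁ ∘ facts) ,
         All.tabulate (proj₁ ∘ proj₂ ∘ facts) ,
         AllPairs-map-local pairFacts
           (λ (e<d , out , hk) (e′<d , out′ , hk′) → from (below-pair⇔ e<d e′<d out out′ hk hk′)) (AllPairs.map⁻ compatsU) ,
         All.tabulate (proj₂ ∘ proj₂ ∘ facts))
    where
    lookup-< : ∀ {x} → x ∈ a → proj₁ x < d
    lookup-< = head-<d heads
    heads-U : map proj₁ (map toU a) ≡ descents U
    heads-U = trans (sym (map-∘ a)) (trans heads (sym descents-U))

  ValidUnderH⇔ : ∀ {b} → map proj₁ b ≡ descentsAbove π d →
    ValidUnderH b ⇔ (All EndsInsideH b × IsVHC S (map toS b))
  ValidUnderH⇔ {b} heads = mk⇔
    (λ (hks , noneAboves , compats , compats-H) →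
      let facts : ∀ {x} → x ∈ b → EndsInsideH x × IsHook S (toS x) × NothingAbove S (toS x)
          facts x∈ = above-hook⇒ (proj₁ (lookup-∈ x∈)) (proj₂ (lookup-∈ x∈))
                       (All.lookup hks x∈) (All.lookup noneAboves x∈) (All.lookup compats-H x∈)
          pairFacts : All (λ x → d < proj₁ x × IsHook S (toS x)) b
          pairFacts = All.tabulate λ x∈ → proj₁ (lookup-∈ x∈) , proj₁ (proj₂ (facts x∈))
      in All.tabulate (proj₁ ∘ facts) ,
         heads-S ,
         All.map⁺ (All.tabulate (proj₁ ∘ proj₂ ∘ facts)) ,
         All.map⁺ (All.tabulate (proj₂ ∘ proj₂ ∘ facts)) ,
         AllPairs.map⁺ (AllPairs-map-local pairFacts
           (λ (d<e , hk) (d<e′ , hk′) → to (above-pair⇔ d<e d<e′ hk hk′)) compats))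
    (λ (insides , _ , hksS , noneAbovesS , compatsS) →
      let hksS′ = All.map⁻ hksS
          facts : ∀ {x} → x ∈ b → IsHook π x × NothingAbove π x × Compatible π H x
          facts x∈ = above-hook⇐ (proj₁ (lookup-∈ x∈)) (All.lookup insides x∈) (All.lookup hksS′ x∈) (All.lookup (All.map⁻ noneAbovesS) x∈)
          pairFacts : All (λ x → d < proj₁ x × IsHook S (toS x)) b
          pairFacts = All.tabulate λ x∈ → proj₁ (lookup-∈ x∈) , All.lookup hksS′ x∈
      in All.tabulate (proj₁ ∘ facts) ,
         All.tabulate (proj₁ ∘ proj₂ ∘ facts) ,
         AllPairs-map-local pairFacts
           (λ (d<e , hk) (d<e′ , hk′) → from (above-pair⇔ d<e d<e′ hk hk′)) (AllPairs.map⁻ compatsS) ,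
         All.tabulate (proj₂ ∘ proj₂ ∘ facts))
    where
    lookup-∈ : ∀ {x} → x ∈ b → d < proj₁ x × proj₁ x < j
    lookup-∈ = head-∈⟨d,j⟩ heads
    heads-S : map proj₁ (map toS b) ≡ descents S
    heads-S = begin
      map proj₁ (map toS b)           ≡⟨ map-∘ b ⟨
      map ((_∸ d) ∘ proj₁) b          ≡⟨ map-∘ b ⟩
      map (_∸ d) (map proj₁ b)        ≡⟨ cong (map (_∸ d)) (trans heads descentsAbove≡) ⟩
      map (_∸ d) (map σS (descents S)) ≡⟨ map-∘ (descents S) ⟨
      map (λ x → d + x ∸ d) (descents S) ≡⟨ map-id-local (All.tabulate (λ _ → m+n∸m≡n d _)) ⟩
      descents S                      ∎
      where open ≡-Reasoning

  IsVHC-split⇔ : ∀ {a b} → map proj₁ a ≡ descentsBelow π d → map proj₁ b ≡ descentsAbove π d →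
    IsVHC π (a ++ H ∷ b) ⇔ ((All EndsOutsideH a × IsVHC U (map toU a)) × (All EndsInsideH b × IsVHC S (map toS b)))
  IsVHC-split⇔ {a} {b} heads-a heads-b = mk⇔
    (λ (_ , hks , noneAboves , compats) →
      let hks-a , hks-H∷b = All.++⁻ a hks
          noneAboves-a , noneAboves-H∷b = All.++⁻ a noneAboves
          compats-a , compats-a-H , _ , compats-H-b , compats-b = AllPairs-++-∷⁻ a compats
      in to (ValidBeforeH⇔ heads-a) (hks-a , noneAboves-a , compats-a , compats-a-H) ,
         to (ValidUnderH⇔ heads-b) (All.tail hks-H∷b , All.tail noneAboves-H∷b , compats-b , compats-H-b))
    (λ ((outs , vhc-U) , (insides , vhc-S)) →
      let hks-a , noneAboves-a , compats-a , compats-a-H = from (ValidBeforeH⇔ heads-a) (outs , vhc-U)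
          hks-b , noneAboves-b , compats-b , compats-H-b = from (ValidUnderH⇔ heads-b) (insides , vhc-S)
          compats-a-b = All.tabulate λ x∈ → All.tabulate λ y∈ →
            below-above-compatible (head-<d heads-a x∈) (All.lookup outs x∈) (All.lookup hks-a x∈)
              (proj₁ (head-∈⟨d,j⟩ heads-b y∈)) (All.lookup insides y∈) (All.lookup hks-b y∈)
      in heads ,
         All.++⁺ hks-a (hj ∷ hks-b) ,
         All.++⁺ noneAboves-a (NothingAbove′⇒ π H nothingAbove-H ∷ noneAboves-b) ,
         AllPairs-++-∷⁺ compats-a compats-a-H compats-a-b compats-H-b compats-b)
    where
    heads : map proj₁ (a ++ H ∷ b) ≡ descents π
    heads = begin
      map proj₁ (a ++ H ∷ b)                       ≡⟨ map-++ proj₁ a (H ∷ b) ⟩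
      map proj₁ a ++ d ∷ map proj₁ b               ≡⟨ cong₂ (λ xs ys → xs ++ d ∷ ys) heads-a heads-b ⟩
      descentsBelow π d ++ d ∷ descentsAbove π d   ≡⟨ descents-split π (proj₁ tb) ⟨
      descents π                                   ∎
      where open ≡-Reasoning

  filter-endsOutsideH : ∀ e → e < d →
    filter (λ k → endsOutsideH? (e , k)) (consecutive (suc e) (d ∸ e) ++ consecutive (suc d) δ ++ consecutive (suc j) (n ∸ j))
      ≡ consecutive (suc e) (d ∸ e) ++ consecutive (suc j) (n ∸ j)
  filter-endsOutsideH e e<d = trans (filter-++ outside? (consecutive (suc e) (d ∸ e)) _)
    (cong₂ _++_ (filter-all outside? (All.tabulate (inj₁ ∘ ≤-pred ∘ proj₂ ∘ ∈-consecutive-∸⁻ (s≤s (<⇒≤ e<d)))))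
      (trans (filter-++ outside? (consecutive (suc d) δ) _)
        (cong₂ _++_ (filter-none outside? (All.tabulate under-H))
                    (filter-all outside? (All.tabulate (inj₂ ∘ proj₁ ∘ ∈-consecutive⁻))))))
    where
    outside? : Decidable (λ k → EndsOutsideH (e , k))
    outside? k = endsOutsideH? (e , k)
    under-H : ∀ {k} → k ∈ consecutive (suc d) δ → ¬ EndsOutsideH (e , k)
    under-H k∈ (inj₁ k≤d) = <⇒≱ (proj₁ (∈-consecutive-∸⁻ (s≤s (<⇒≤ d<j)) k∈)) k≤d
    under-H k∈ (inj₂ j<k) = <⇒≱ j<k (≤-pred (proj₂ (∈-consecutive-∸⁻ (s≤s (<⇒≤ d<j)) k∈)))

  τU-range : ∀ {e} → e < d →
    map τU (filter (λ k → endsOutsideH? (e , k)) (range (suc e) n)) ≡ range (suc e) (length U)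
  τU-range {e} e<d = begin
    map τU (filter (λ k → endsOutsideH? (e , k)) (range (suc e) n))
      ≡⟨ cong (map τU ∘ filter (λ k → endsOutsideH? (e , k))) (range≡consecutive (suc e) n) ⟩
    map τU (filter (λ k → endsOutsideH? (e , k)) (consecutive (suc e) (suc n ∸ suc e)))
      ≡⟨ cong (map τU ∘ filter (λ k → endsOutsideH? (e , k))) (trans
           (consecutive-split (s≤s (<⇒≤ e<d)) (s≤s d≤n))
           (cong (consecutive (suc e) (d ∸ e) ++_) (consecutive-split (s≤s (<⇒≤ d<j)) (s≤s j≤n)))) ⟩
    map τU (filter (λ k → endsOutsideH? (e , k)) (consecutive (suc e) (d ∸ e) ++ consecutive (suc d) δ ++ consecutive (suc j) (n ∸ j)))
      ≡⟨ cong (map τU) (filter-endsOutsideH e e<d) ⟩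
    map τU (consecutive (suc e) (d ∸ e) ++ consecutive (suc j) (n ∸ j))
      ≡⟨ map-++ τU (consecutive (suc e) (d ∸ e)) _ ⟩
    map τU (consecutive (suc e) (d ∸ e)) ++ map τU (consecutive (suc j) (n ∸ j))
      ≡⟨ cong₂ _++_ (map-id-local (All.tabulate (τU-≤ ∘ ≤-pred ∘ proj₂ ∘ ∈-consecutive-∸⁻ (s≤s (<⇒≤ e<d)))))
                    (map-cong-local (All.tabulate (τU-> ∘ <-trans d<j ∘ proj₁ ∘ ∈-consecutive⁻))) ⟩
    consecutive (suc e) (d ∸ e) ++ map (_∸ δ) (consecutive (suc j) (n ∸ j))
      ≡⟨ cong (λ a → consecutive (suc e) (d ∸ e) ++ map (_∸ δ) (consecutive a (n ∸ j))) 1+j≡δ+[1+d] ⟩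
    consecutive (suc e) (d ∸ e) ++ map (_∸ δ) (consecutive (δ + suc d) (n ∸ j))
      ≡⟨ cong (consecutive (suc e) (d ∸ e) ++_) (map-∸-consecutive δ (suc d) (n ∸ j)) ⟩
    consecutive (suc e) (d ∸ e) ++ consecutive (suc d) (n ∸ j)
      ≡⟨ cong (λ a → consecutive (suc e) (d ∸ e) ++ consecutive (suc a) (n ∸ j)) (m+[n∸m]≡n (<⇒≤ e<d)) ⟨
    consecutive (suc e) (d ∸ e) ++ consecutive (suc e + (d ∸ e)) (n ∸ j)
      ≡⟨ consecutive-++ (suc e) (d ∸ e) (n ∸ j) ⟨
    consecutive (suc e) ((d ∸ e) + (n ∸ j))
      ≡⟨ cong (consecutive (suc e)) (trans (sym (+-∸-comm (n ∸ j) (<⇒≤ e<d))) (cong (_∸ e) (sym length-U))) ⟩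
    consecutive (suc e) (suc (length U) ∸ suc e)
      ≡⟨ range≡consecutive (suc e) (length U) ⟨
    range (suc e) (length U)
      ∎
    where
    open ≡-Reasoning
    1+j≡δ+[1+d] : suc j ≡ δ + suc d
    1+j≡δ+[1+d] = trans (cong suc (trans (sym d+δ≡j) (+-comm d δ))) (sym (+-suc δ d))

  σS-range : ∀ {e′} → e′ < L →
    map (_∸ d) (filter (λ k → endsInsideH? (σS e′ , k)) (range (suc (d + e′)) n)) ≡ range (suc e′) (length S)
  σS-range {e′} e′<L = begin
    map (_∸ d) (filter (_<? j) (range (suc (d + e′)) n))
      ≡⟨ cong (map (_∸ d) ∘ filter (_<? j)) (range≡consecutive (suc (d + e′)) n) ⟩
    map (_∸ d) (filter (_<? j) (consecutive (suc (d + e′)) (suc n ∸ suc (d + e′))))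
      ≡⟨ cong (map (_∸ d) ∘ filter (_<? j)) (consecutive-split 1+d+e′≤j (m≤n⇒m≤1+n j≤n)) ⟩
    map (_∸ d) (filter (_<? j) (consecutive (suc (d + e′)) (j ∸ suc (d + e′)) ++ consecutive j (suc n ∸ j)))
      ≡⟨ cong (map (_∸ d)) (trans (filter-++ (_<? j) (consecutive (suc (d + e′)) (j ∸ suc (d + e′))) _)
           (cong₂ _++_ (filter-all (_<? j) (All.tabulate (proj₂ ∘ ∈-consecutive-∸⁻ 1+d+e′≤j)))
                       (filter-none (_<? j) (All.tabulate (λ k∈ k<j → <⇒≱ k<j (proj₁ (∈-consecutive⁻ {j} {suc n ∸ j} k∈))))))) ⟩
    map (_∸ d) (consecutive (suc (d + e′)) (j ∸ suc (d + e′)) ++ [])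
      ≡⟨ cong (map (_∸ d)) (++-identityʳ _) ⟩
    map (_∸ d) (consecutive (suc (d + e′)) (j ∸ suc (d + e′)))
      ≡⟨ cong (λ a → map (_∸ d) (consecutive a (j ∸ suc (d + e′)))) (+-suc d e′) ⟨
    map (_∸ d) (consecutive (d + suc e′) (j ∸ suc (d + e′)))
      ≡⟨ map-∸-consecutive d (suc e′) _ ⟩
    consecutive (suc e′) (j ∸ suc (d + e′))
      ≡⟨ cong (consecutive (suc e′)) (trans (sym (∸-+-assoc j (suc d) e′)) (cong (_∸ e′) (sym length-S))) ⟩
    consecutive (suc e′) (suc (length S) ∸ suc e′)
      ≡⟨ range≡consecutive (suc e′) (length S) ⟨
    range (suc e′) (length S)
      ∎
    where
    open ≡-Reasoning
    1+d+e′≤j : suc (d + e′) ≤ j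
    1+d+e′≤j = ≤-trans (+-monoʳ-< d e′<L) (subst (d + L ≤_) 1+d+L≡j (n≤1+n _))

  hooksFrom-toU : ∀ {e} → e < d → map toU (filter endsOutsideH? (hooksFrom π e)) ≡ hooksFrom U e
  hooksFrom-toU {e} e<d = begin
    map toU (filter endsOutsideH? (map (e ,_) (range (suc e) n)))
      ≡⟨ cong (map toU) (filter-map endsOutsideH? (e ,_) (range (suc e) n)) ⟩
    map toU (map (e ,_) (filter (endsOutsideH? ∘ (e ,_)) (range (suc e) n)))
      ≡⟨ map-∘ _ ⟨
    map (λ k → e , τU k) (filter (endsOutsideH? ∘ (e ,_)) (range (suc e) n))
      ≡⟨ map-∘ _ ⟩
    map (e ,_) (map τU (filter (endsOutsideH? ∘ (e ,_)) (range (suc e) n)))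
      ≡⟨ cong (map (e ,_)) (τU-range e<d) ⟩
    map (e ,_) (range (suc e) (length U))
      ∎
    where open ≡-Reasoning

  hooksFrom-toS : ∀ {e′} → e′ < L → map toS (filter endsInsideH? (hooksFrom π (σS e′))) ≡ hooksFrom S e′
  hooksFrom-toS {e′} e′<L = begin
    map toS (filter endsInsideH? (map (σS e′ ,_) (range (suc (d + e′)) n)))
      ≡⟨ cong (map toS) (filter-map endsInsideH? (σS e′ ,_) (range (suc (d + e′)) n)) ⟩
    map toS (map (σS e′ ,_) (filter (endsInsideH? ∘ (σS e′ ,_)) (range (suc (d + e′)) n)))
      ≡⟨ map-∘ _ ⟨
    map (λ k → d + e′ ∸ d , k ∸ d) (filter (endsInsideH? ∘ (σS e′ ,_)) (range (suc (d + e′)) n))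
      ≡⟨ map-cong-local (All.tabulate (λ _ → cong (_, _) (m+n∸m≡n d e′))) ⟩
    map (λ k → e′ , k ∸ d) (filter (endsInsideH? ∘ (σS e′ ,_)) (range (suc (d + e′)) n))
      ≡⟨ map-∘ _ ⟩
    map (e′ ,_) (map (_∸ d) (filter (endsInsideH? ∘ (σS e′ ,_)) (range (suc (d + e′)) n)))
      ≡⟨ cong (map (e′ ,_)) (σS-range e′<L) ⟩
    map (e′ ,_) (range (suc e′) (length S))
      ∎
    where open ≡-Reasoning

  hooksBefore : List (List Hook)
  hooksBefore = map (hooksFrom π) (descentsBelow π d)

  hooksUnder : List (List Hook)
  hooksUnder = map (hooksFrom π) (descentsAbove π d)

  count-ValidBefore : count (λ a → all? endsOutsideH? a ×-dec isVHC? U (map toU a)) (choices hooksBefore) ≡ numVHC U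
  count-ValidBefore = begin
    count (λ a → all? endsOutsideH? a ×-dec isVHC? U (map toU a)) (choices hooksBefore)
      ≡⟨ count-choices-filter endsOutsideH? (isVHC? U ∘ map toU) hooksBefore ⟨
    count (isVHC? U ∘ map toU) (choices (map (filter endsOutsideH?) hooksBefore))
      ≡⟨ count-choices-map (isVHC? U) toU (map (filter endsOutsideH?) hooksBefore) ⟨
    count (isVHC? U) (choices (map (map toU) (map (filter endsOutsideH?) hooksBefore)))
      ≡⟨ cong (count (isVHC? U) ∘ choices) hooks-U ⟩
    count (isVHC? U) (choices (map (hooksFrom U) (descents U)))
      ∎
    where
    open ≡-Reasoning
    hooks-U : map (map toU) (map (filter endsOutsideH?) hooksBefore) ≡ map (hooksFrom U) (descents U)
    hooks-U = begin
      map (map toU) (map (filter endsOutsideH?) (map (hooksFrom π) (descentsBelow π d)))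
        ≡⟨ trans (sym (map-∘ _)) (sym (map-∘ _)) ⟩
      map (λ e → map toU (filter endsOutsideH? (hooksFrom π e))) (descentsBelow π d)
        ≡⟨ map-cong-local (All.tabulate (hooksFrom-toU ∘ descentsBelow-<)) ⟩
      map (hooksFrom U) (descentsBelow π d)
        ≡⟨ cong (map (hooksFrom U)) descents-U ⟨
      map (hooksFrom U) (descents U)
        ∎

  count-ValidUnder : count (λ b → all? endsInsideH? b ×-dec isVHC? S (map toS b)) (choices hooksUnder) ≡ numVHC S
  count-ValidUnder = begin
    count (λ b → all? endsInsideH? b ×-dec isVHC? S (map toS b)) (choices hooksUnder)
      ≡⟨ count-choices-filter endsInsideH? (isVHC? S ∘ map toS) hooksUnder ⟨
    count (isVHC? S ∘ map toS) (choices (map (filter endsInsideH?) hooksUnder))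
      ≡⟨ count-choices-map (isVHC? S) toS (map (filter endsInsideH?) hooksUnder) ⟨
    count (isVHC? S) (choices (map (map toS) (map (filter endsInsideH?) hooksUnder)))
      ≡⟨ cong (count (isVHC? S) ∘ choices) hooks-S ⟩
    count (isVHC? S) (choices (map (hooksFrom S) (descents S)))
      ∎
    where
    open ≡-Reasoning
    <L : ∀ {e′} → e′ ∈ descents S → e′ < L
    <L e′∈ = subst (_ <_) length-S (proj₁ (proj₂ (proj₂ (∈-filter⁻ (isDescent? S) {xs = positions S} e′∈))))
    hooks-S : map (map toS) (map (filter endsInsideH?) hooksUnder) ≡ map (hooksFrom S) (descents S)
    hooks-S = begin
      map (map toS) (map (filter endsInsideH?) (map (hooksFrom π) (descentsAbove π d)))
        ≡⟨ trans (sym (map-∘ _)) (sym (map-∘ _)) ⟩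
      map (λ e → map toS (filter endsInsideH? (hooksFrom π e))) (descentsAbove π d)
        ≡⟨ cong (map _) descentsAbove≡ ⟩
      map (λ e → map toS (filter endsInsideH? (hooksFrom π e))) (map σS (descents S))
        ≡⟨ map-∘ _ ⟨
      map (λ e′ → map toS (filter endsInsideH? (hooksFrom π (σS e′)))) (descents S)
        ≡⟨ map-cong-local (All.tabulate (hooksFrom-toS ∘ <L)) ⟩
      map (hooksFrom S) (descents S)
        ∎

  numVHCThrough-H : numVHCThrough π d j ≡ numVHC U * numVHC S
  numVHCThrough-H = begin
    sum (map (λ a → count (λ b → isVHC? π (a ++ H ∷ b)) (choices hooksUnder)) (choices hooksBefore))
      ≡⟨ sum-map-cong-∈ (choices hooksBefore) (λ a∈ → count-const-× _ (ValidBefore? _) ValidUnder? (choices hooksUnder)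
           (λ b∈ → IsVHC-split⇔ (∈-choices⇒heads _ _ a∈) (∈-choices⇒heads _ _ b∈))) ⟩
    sum (map (λ a → indicator (ValidBefore? a) * count ValidUnder? (choices hooksUnder)) (choices hooksBefore))
      ≡⟨ sum-map-*ʳ _ (indicator ∘ ValidBefore?) (choices hooksBefore) ⟩
    sum (map (indicator ∘ ValidBefore?) (choices hooksBefore)) * count ValidUnder? (choices hooksUnder)
      ≡⟨ cong₂ _*_ (trans (sym (count≡sum-indicator ValidBefore? (choices hooksBefore))) count-ValidBefore) count-ValidUnder ⟩
    numVHC U * numVHC S
      ∎
    where
    open ≡-Reasoning
    ValidBefore? : Decidable (λ a → All EndsOutsideH a × IsVHC U (map toU a))
    ValidBefore? a = all? endsOutsideH? a ×-dec isVHC? U (map toU a)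
    ValidUnder? : Decidable (λ b → All EndsInsideH b × IsVHC S (map toS b))
    ValidUnder? b = all? endsInsideH? b ×-dec isVHC? S (map toS b)

numVHCThrough-tailBound : ∀ π {d} → TailBound π d → ∀ k →
  numVHCThrough π d k ≡ indicator (isHook? π (d , k)) * (numVHC (unsheltered π (d , k)) * numVHC (sheltered π (d , k)))
numVHCThrough-tailBound π {d} tb k with isHook? π (d , k)
... | yes hook = trans (TailBoundHook.numVHCThrough-H π d tb k hook) (sym (+-identityʳ _))
... | no ¬hook = numVHCThrough-nonHook π ¬hook

corollary1 : (n : ℕ) (π : List ℕ) → π ↭ range 1 n →
    (d : ℕ) → TailBound π d →
    numVHC π ≡ sum (map (λ H → numVHC (unsheltered π H) * numVHC (sheltered π H)) (SW π d))
corollary1 _ π _ d tb = begin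
  numVHC π
    ≡⟨ numVHC≡sum-numVHCThrough π (proj₁ tb) ⟩
  sum (map (numVHCThrough π d) (range (suc d) (length π)))
    ≡⟨ sum-map-cong-∈ (range (suc d) (length π)) (λ {k} _ → numVHCThrough-tailBound π tb k) ⟩
  sum (map (λ k → indicator (isHook? π (d , k)) * F (d , k)) (range (suc d) (length π)))
    ≡⟨ sum-map-map (λ H → indicator (isHook? π H) * F H) (d ,_) (range (suc d) (length π)) ⟨
  sum (map (λ H → indicator (isHook? π H) * F H) (map (d ,_) (range (suc d) (length π))))
    ≡⟨ sum-map-filter (isHook? π) F (map (d ,_) (range (suc d) (length π))) ⟨
  sum (map F (SW π d))
    ∎
  where
  open ≡-Reasoning
  F : Hook → ℕ
  F H = numVHC (unsheltered π H) * numVHC (sheltered π H)
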